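{- Let $\tau_1=1\underline{2}34$ and $\tau_2=1\underline{2}43$. For $n\ge2$ and $1\le s\le n-1$ let $P_{n,\tau_1,s}(x)=\sum x^{pmp_{\tau_1}(\sigma)}$ over all $\sigma\in S_n$ whose last ascent is at position $s$, and $P_{n,\tau_2,s}(x)=\sum x^{pmp_{\tau_2}(\sigma)}$ over all $\sigma\in S_n$ whose last descent is at position $s$. Then $P_{n,\tau_1,s}(x)=P_{n,\tau_2,s}(x)$ for all $1\le s\le n-1$.
   Context: $\sigma\in S_n$ has its last ascent at position $s$ if $\sigma_s<\sigma_{s+1}>\sigma_{s+2}>\cdots>\sigma_n$, and its last descent at position $s$ if $\sigma_s>\sigma_{s+1}<\sigma_{s+2}<\cdots<\sigma_n$. $\sigma$ has a $1\underline{2}34$-match at position $j$ if there exist $i<j<a<b$ with $\sigma_i<\sigma_j<\sigma_a<\sigma_b$, and a $1\underline{2}43$-match at position $j$ if there exist $i<j<a<b$ with $\sigma_i<\sigma_j<\sigma_b<\sigma_a$; $pmp$ counts the positions with a match. -}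

module Defs where

open import Data.Nat using (ℕ; zero; suc; _+_; _<ᵇ_; _≡ᵇ_)
open import Data.Bool using (Bool; true; false; _∧_; _∨_; not; if_then_else_)
open import Data.List using (List; []; _∷_; map; concatMap; filter; length; upTo; foldr)
open import Data.List.Relation.Unary.Unique.Propositional using (Unique)
open import Data.List.Relation.Unary.Unique.Propositional.Properties using ()
open import Relation.Nullary using (Dec)
import Data.List.Relation.Unary.Unique.DecPropositional as UDec
open import Data.Nat.Properties using (_≟_)

-- Permutations are written in one-line notation σ = σ₁ σ₂ … σₙ as a list
-- of natural numbers; positions are 1-indexed.

-- σ at position i (1-indexed); 0 for out-of-range positions (never used).
at : List ℕ → ℕ → ℕ
at []       _             = 0
at (x ∷ xs) zero          = 0
at (x ∷ xs) (suc zero)    = x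
at (x ∷ xs) (suc (suc i)) = at xs (suc i)

range : ℕ → ℕ → List ℕ
range a b = filter (λ i → Data.Nat._≤?_ a i) (map suc (upTo b))

anyIn : List ℕ → (ℕ → Bool) → Bool
anyIn xs p = foldr (λ x r → p x ∨ r) false xs

allIn : List ℕ → (ℕ → Bool) → Bool
allIn xs p = foldr (λ x r → p x ∧ r) true xs

countIn : List ℕ → (ℕ → Bool) → ℕ
countIn xs p = foldr (λ x r → if p x then suc r else r) 0 xs

words : ℕ → ℕ → List (List ℕ)
words n zero    = [] ∷ []
words n (suc k) = concatMap (λ w → map (λ x → x ∷ w) (range 1 n)) (words n k)

Sym : ℕ → List (List ℕ)
Sym n = filter (UDec.unique? _≟_) (words n n)

lastAscentAt : ℕ → List ℕ → ℕ → Bool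
lastAscentAt n σ s =
  (at σ s <ᵇ at σ (suc s)) ∧
  allIn (range (suc s) (n Data.Nat.∸ 1)) (λ k → at σ (suc k) <ᵇ at σ k)

lastDescentAt : ℕ → List ℕ → ℕ → Bool
lastDescentAt n σ s =
  (at σ (suc s) <ᵇ at σ s) ∧
  allIn (range (suc s) (n Data.Nat.∸ 1)) (λ k → at σ k <ᵇ at σ (suc k))

match1234 : ℕ → List ℕ → ℕ → Bool
match1234 n σ j =
  anyIn (range 1 n) λ i → anyIn (range 1 n) λ a → anyIn (range 1 n) λ b →
    (i <ᵇ j) ∧ (j <ᵇ a) ∧ (a <ᵇ b) ∧
    (at σ i <ᵇ at σ j) ∧ (at σ j <ᵇ at σ a) ∧ (at σ a <ᵇ at σ b)

match1243 : ℕ → List ℕ → ℕ → Bool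
match1243 n σ j =
  anyIn (range 1 n) λ i → anyIn (range 1 n) λ a → anyIn (range 1 n) λ b →
    (i <ᵇ j) ∧ (j <ᵇ a) ∧ (a <ᵇ b) ∧
    (at σ i <ᵇ at σ j) ∧ (at σ j <ᵇ at σ b) ∧ (at σ b <ᵇ at σ a)

pmp1234 : ℕ → List ℕ → ℕ
pmp1234 n σ = countIn (range 1 n) (match1234 n σ)

pmp1243 : ℕ → List ℕ → ℕ
pmp1243 n σ = countIn (range 1 n) (match1243 n σ)

countPerms : List (List ℕ) → (List ℕ → Bool) → ℕ
countPerms xs p = foldr (λ x r → if p x then suc r else r) 0 xs

-- coefficient of x^k in P_{n,τ₁,s}(x) = Σ_{σ ∈ S_n, last ascent at s} x^{pmp_{τ₁}(σ)}
coeffP₁ : ℕ → ℕ → ℕ → ℕ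
coeffP₁ n s k = countPerms (Sym n) (λ σ → lastAscentAt n σ s ∧ (pmp1234 n σ ≡ᵇ k))

-- coefficient of x^k in P_{n,τ₂,s}(x) = Σ_{σ ∈ S_n, last descent at s} x^{pmp_{τ₂}(σ)}
coeffP₂ : ℕ → ℕ → ℕ → ℕ
coeffP₂ n s k = countPerms (Sym n) (λ σ → lastDescentAt n σ s ∧ (pmp1243 n σ ≡ᵇ k))

-- Encode σ ∈ Sₙ by its code k₁ … kₙ, where kᵢ counts the later letters exceeding σᵢ; the codes are
-- exactly the sequences with kᵢ ≤ n − i. Position i is a 1_2_34-match iff some earlier letter is
-- smaller and σᵢ lies below the largest later letter that starts an ascending pair; on codes this
-- reads riseGap (kᵢ₊₁ … kₙ) < kᵢ, and the same holds for 1_2_43 with descending pairs and fallGap.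
-- The bijection ψ of codes satisfies fallGap ∘ ψ = riseGap and changes a letter kᵢ only where
-- riseGap < kᵢ fails, where neither side has a match and the change is invisible to later
-- positions; so pmp₁₂₃₄ ∘ decode = pmp₁₂₄₃ ∘ decode ∘ ψ. Finally "last ascent at s" means the code
-- is kₛ > 0 = kₛ₊₁ = ⋯ = kₙ, "last descent at s" that it ends with kₛ ≤ n−s−1, n−s−1, …, 1, 0,
-- and ψ exchanges the two shapes.

module Submission where

open import Defs
open import Data.Empty using (⊥; ⊥-elim)
open import Data.Unit using (⊤; tt)
open import Data.Bool using (Bool; true; false; _∧_; _∨_; not; if_then_else_; T)
open import Data.Bool.Properties using (∧-zeroʳ)
open import Data.Nat
open import Data.Nat.Properties
open import Data.List using (List; []; _∷_; foldr; map; length; upTo; downFrom; replicate; concatMap; filter)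
open import Data.List.Properties using (length-map; length-replicate; ∷-injective; map-upTo; map-injective)
open import Data.List.Membership.Propositional using (_∈_; _∉_; find; lose)
open import Data.List.Membership.Propositional.Properties
  using (∈-map⁺; ∈-map⁻; ∈-upTo⁺; ∈-upTo⁻; ∈-filter⁺; ∈-filter⁻; ∈-concatMap⁺; ∈-concatMap⁻)
open import Data.List.Membership.Propositional.Properties.WithK using (unique∧set⇒bag)
open import Data.List.Relation.Unary.Any using (here; there)
open import Data.List.Relation.Unary.All as All using (All; []; _∷_)
open import Data.List.Relation.Unary.AllPairs using ([]; _∷_)
open import Data.List.Relation.Unary.Unique.Propositional using (Unique)
open import Data.List.Relation.Unary.Unique.Propositional.Properties using (map⁺; ++⁺; upTo⁺; filter⁺)
import Data.List.Relation.Unary.Unique.DecPropositional as UniqueDec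
open import Data.List.Relation.Binary.Permutation.Propositional using (_↭_; refl; prep; swap; trans)
open import Data.List.Relation.Binary.BagAndSetEquality using (∼bag⇒↭)
open import Data.Product using (Σ; _×_; _,_; proj₁; proj₂)
open import Data.Sum using (_⊎_; inj₁; inj₂)
open import Function.Base using (_∘_)
open import Function.Bundles using (mk⇔)
open import Relation.Binary.Definitions using (tri<; tri≈; tri>)
open import Relation.Binary.PropositionalEquality hiding (trans)
import Relation.Binary.PropositionalEquality as ≡
open import Relation.Nullary using (yes; no)

T-ext : ∀ {a b} → (T a → T b) → (T b → T a) → a ≡ b
T-ext {false} {false} _ _ = refl
T-ext {false} {true}  _ g = ⊥-elim (g tt)
T-ext {true}  {false} f _ = ⊥-elim (f tt)
T-ext {true}  {true}  _ _ = refl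

T-∧⁻ : ∀ {a b} → T (a ∧ b) → T a × T b
T-∧⁻ {true} {true} _ = tt , tt

T-∧⁺ : ∀ {a b} → T a → T b → T (a ∧ b)
T-∧⁺ {true} {true} _ _ = tt

T-∨⁻ : ∀ {a b} → T (a ∨ b) → T a ⊎ T b
T-∨⁻ {true}          _ = inj₁ tt
T-∨⁻ {false} {true}  _ = inj₂ tt

T-∨ˡ : ∀ {a b} → T a → T (a ∨ b)
T-∨ˡ {true} _ = tt

T-∨ʳ : ∀ {a b} → T b → T (a ∨ b)
T-∨ʳ {true}  _ = tt
T-∨ʳ {false} t = t

T-not⁻ : ∀ {b} → T (not b) → T b → ⊥
T-not⁻ {true} ()

T-not⁺ : ∀ {b} → (T b → ⊥) → T (not b)
T-not⁺ {false} _ = tt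
T-not⁺ {true}  h = h tt

<ᵇ⇒<′ : ∀ {m n} → T (m <ᵇ n) → m < n
<ᵇ⇒<′ {m} {n} = <ᵇ⇒< m n

<ᵇ-true : ∀ {m n} → m < n → (m <ᵇ n) ≡ true
<ᵇ-true {m} {n} m<n with m <ᵇ n | <⇒<ᵇ m<n
... | true | _ = refl

<ᵇ-false : ∀ {m n} → n ≤ m → (m <ᵇ n) ≡ false
<ᵇ-false {m} {n} n≤m with m <ᵇ n in eq
... | false = refl
... | true  = ⊥-elim (<⇒≱ (<ᵇ⇒<′ {m} {n} (subst T (sym eq) tt)) n≤m)

<ᵇ-irrefl : ∀ n → (n <ᵇ n) ≡ false
<ᵇ-irrefl n = <ᵇ-false {n} {n} ≤-refl

≡ᵇ-refl : ∀ n → (n ≡ᵇ n) ≡ true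
≡ᵇ-refl zero    = refl
≡ᵇ-refl (suc n) = ≡ᵇ-refl n

≡ᵇ-false : ∀ {m n} → m ≢ n → (m ≡ᵇ n) ≡ false
≡ᵇ-false {zero}  {zero}  m≢n = ⊥-elim (m≢n refl)
≡ᵇ-false {zero}  {suc n} _   = refl
≡ᵇ-false {suc m} {zero}  _   = refl
≡ᵇ-false {suc m} {suc n} m≢n = ≡ᵇ-false (λ e → m≢n (cong suc e))

⊓-<ᵇ : ∀ a b c → (a ⊓ b <ᵇ c) ≡ (a <ᵇ c) ∨ (b <ᵇ c)
⊓-<ᵇ a b c with ≤-total a b
... | inj₁ a≤b rewrite m≤n⇒m⊓n≡m a≤b = T-ext T-∨ˡ from
  where
  from : T ((a <ᵇ c) ∨ (b <ᵇ c)) → T (a <ᵇ c)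
  from h with T-∨⁻ {a <ᵇ c} h
  ... | inj₁ q = q
  ... | inj₂ q = <⇒<ᵇ (≤-<-trans a≤b (<ᵇ⇒<′ {b} {c} q))
... | inj₂ b≤a rewrite m≥n⇒m⊓n≡n b≤a = T-ext (T-∨ʳ {a <ᵇ c}) from
  where
  from : T ((a <ᵇ c) ∨ (b <ᵇ c)) → T (b <ᵇ c)
  from h with T-∨⁻ {a <ᵇ c} h
  ... | inj₁ q = <⇒<ᵇ (≤-<-trans b≤a (<ᵇ⇒<′ {a} {c} q))
  ... | inj₂ q = q

count : {A : Set} → List A → (A → Bool) → ℕ
count xs p = foldr (λ x r → if p x then suc r else r) 0 xs

count-↭ : {A : Set} {xs ys : List A} (p : A → Bool) → xs ↭ ys → count xs p ≡ count ys p
count-↭ p refl = refl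
count-↭ {xs = x ∷ _} p (prep _ q) with p x
... | true  = cong suc (count-↭ p q)
... | false = count-↭ p q
count-↭ {xs = x ∷ y ∷ _} p (swap _ _ q) with p x | p y
... | true  | true  = cong (λ z → suc (suc z)) (count-↭ p q)
... | true  | false = cong suc (count-↭ p q)
... | false | true  = cong suc (count-↭ p q)
... | false | false = count-↭ p q
count-↭ p (trans q r) = ≡.trans (count-↭ p q) (count-↭ p r)

count-map : {A B : Set} (f : A → B) (p : B → Bool) (xs : List A) →
  count (map f xs) p ≡ count xs (λ x → p (f x))
count-map f p [] = refl
count-map f p (x ∷ xs) with p (f x)
... | true  = cong suc (count-map f p xs)
... | false = count-map f p xs

count-cong : {A : Set} (xs : List A) {p q : A → Bool} →
  (∀ {x} → x ∈ xs → p x ≡ q x) → count xs p ≡ count xs q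
count-cong [] h = refl
count-cong (x ∷ xs) {p} {q} h with p x | q x | h (here refl)
... | true  | true  | _ = cong suc (count-cong xs (λ m → h (there m)))
... | false | false | _ = count-cong xs (λ m → h (there m))

count-false : {A : Set} (xs : List A) → count xs (λ _ → false) ≡ 0
count-false []       = refl
count-false (x ∷ xs) = count-false xs

anyIn⁻ : ∀ (xs : List ℕ) p → T (anyIn xs p) → Σ ℕ λ x → x ∈ xs × T (p x)
anyIn⁻ (x ∷ xs) p t with T-∨⁻ {p x} t
... | inj₁ q = x , here refl , q
... | inj₂ q with anyIn⁻ xs p q
...   | y , m , r = y , there m , r

anyIn⁺ : ∀ {xs : List ℕ} p {x} → x ∈ xs → T (p x) → T (anyIn xs p)
anyIn⁺ {y ∷ xs} p (here refl) q = T-∨ˡ {p y} q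
anyIn⁺ {y ∷ xs} p (there m)   q = T-∨ʳ {p y} (anyIn⁺ p m q)

allIn⁻ : ∀ (xs : List ℕ) p {x} → T (allIn xs p) → x ∈ xs → T (p x)
allIn⁻ (y ∷ xs) p t (here refl) = proj₁ (T-∧⁻ {p y} t)
allIn⁻ (y ∷ xs) p t (there m)   = allIn⁻ xs p (proj₂ (T-∧⁻ {p y} t)) m

allIn⁺ : ∀ (xs : List ℕ) p → (∀ {x} → x ∈ xs → T (p x)) → T (allIn xs p)
allIn⁺ []       p h = tt
allIn⁺ (y ∷ xs) p h = T-∧⁺ {p y} (h (here refl)) (allIn⁺ xs p (λ m → h (there m)))

anyIn-map : ∀ (f : ℕ → ℕ) (W : List ℕ) p → anyIn (map f W) p ≡ anyIn W (λ z → p (f z))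
anyIn-map f []      p = refl
anyIn-map f (y ∷ W) p = cong (p (f y) ∨_) (anyIn-map f W p)

anyIn-cong : ∀ (W : List ℕ) {p q} → (∀ z → p z ≡ q z) → anyIn W p ≡ anyIn W q
anyIn-cong []      h = refl
anyIn-cong (y ∷ W) h = cong₂ _∨_ (h y) (anyIn-cong W h)

anyIn-∧ˡ : ∀ (W : List ℕ) a p → anyIn W (λ z → a ∧ p z) ≡ a ∧ anyIn W p
anyIn-∧ˡ W false p = anyIn-false W
  where
  anyIn-false : ∀ W → anyIn W (λ _ → false) ≡ false
  anyIn-false []      = refl
  anyIn-false (_ ∷ W) = anyIn-false W
anyIn-∧ˡ W true p = refl

anyIn-at⁻ : ∀ (W : List ℕ) p → T (anyIn W p) → Σ ℕ λ i → 1 ≤ i × i ≤ length W × T (p (at W i))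
anyIn-at⁻ (y ∷ W) p t with T-∨⁻ {p y} t
... | inj₁ q = 1 , ≤-refl , s≤s z≤n , q
... | inj₂ q with anyIn-at⁻ W p q
...   | suc i , _ , i≤ , r = suc (suc i) , s≤s z≤n , s≤s i≤ , r

anyIn-at⁺ : ∀ (W : List ℕ) p i → 1 ≤ i → i ≤ length W → T (p (at W i)) → T (anyIn W p)
anyIn-at⁺ (y ∷ W) p (suc zero)    _ _       q = T-∨ˡ {p y} q
anyIn-at⁺ (y ∷ W) p (suc (suc i)) _ (s≤s h) q = T-∨ʳ {p y} (anyIn-at⁺ W p (suc i) (s≤s z≤n) h q)

range-1 : ∀ n → range 1 n ≡ map suc (upTo n)
range-1 n = go (upTo n)
  where
  go : (xs : List ℕ) → filter (1 ≤?_) (map suc xs) ≡ map suc xs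
  go []       = refl
  go (x ∷ xs) = cong (suc x ∷_) (go xs)

range-1-suc : ∀ n → range 1 (suc n) ≡ 1 ∷ map suc (range 1 n)
range-1-suc n rewrite range-1 (suc n) | range-1 n = cong (λ z → 1 ∷ map suc z) (sym (map-upTo suc n))

∈-range⁻ : ∀ {a b x} → x ∈ range a b → a ≤ x × x ≤ b
∈-range⁻ {a} {b} m with ∈-filter⁻ (a ≤?_) {xs = map suc (upTo b)} m
... | m' , a≤x with ∈-map⁻ suc m'
...   | y , ym , refl = a≤x , ∈-upTo⁻ ym

∈-range⁺ : ∀ {a b x} → a ≤ suc x → suc x ≤ b → suc x ∈ range a b
∈-range⁺ {a} a≤x x≤b = ∈-filter⁺ (a ≤?_) (∈-map⁺ suc (∈-upTo⁺ x≤b)) a≤x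

-- Matches found by a left-to-right scan

-- Q v x y: the later letters x, then y, complete a match at a letter of value v.

Pattern : Set
Pattern = ℕ → ℕ → ℕ → Bool

rising falling : Pattern
rising  v x y = (v <ᵇ x) ∧ (x <ᵇ y)
falling v x y = (v <ᵇ y) ∧ (y <ᵇ x)

matchAt : Pattern → ℕ → List ℕ → ℕ → Bool
matchAt Q n σ j =
  anyIn (range 1 n) λ i → anyIn (range 1 n) λ a → anyIn (range 1 n) λ b →
    (i <ᵇ j) ∧ (j <ᵇ a) ∧ (a <ᵇ b) ∧ (at σ i <ᵇ at σ j) ∧ Q (at σ j) (at σ a) (at σ b)

pairAbove : Pattern → ℕ → List ℕ → Bool
pairAbove Q v []      = false
pairAbove Q v (y ∷ W) = anyIn W (Q v y) ∨ pairAbove Q v W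

record PairAbove (Q : Pattern) (v : ℕ) (W : List ℕ) (lo : ℕ) : Set where
  constructor pairAt
  field
    a b   : ℕ
    lo<a  : lo < a
    a<b   : a < b
    b≤    : b ≤ length W
    holds : T (Q v (at W a) (at W b))

PairAbove-∷⁻ : ∀ {Q v x U lo} → PairAbove Q v (x ∷ U) (suc lo) → PairAbove Q v U lo
PairAbove-∷⁻ (pairAt (suc (suc a)) (suc (suc b)) (s≤s lo<a) (s≤s a<b) (s≤s b≤) q) =
  pairAt (suc a) (suc b) lo<a a<b b≤ q

PairAbove-∷⁺ : ∀ {Q v x U lo} → PairAbove Q v U lo → PairAbove Q v (x ∷ U) (suc lo)
PairAbove-∷⁺ (pairAt (suc a) (suc b) lo<a a<b b≤ q) =
  pairAt (suc (suc a)) (suc (suc b)) (s≤s lo<a) (s≤s a<b) (s≤s b≤) q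

pairAbove⁻ : ∀ Q v W → T (pairAbove Q v W) → PairAbove Q v W 0
pairAbove⁻ Q v (y ∷ W) t with T-∨⁻ {anyIn W (Q v y)} t
... | inj₁ q with anyIn-at⁻ W (Q v y) q
...   | suc i , _ , i≤ , r = pairAt 1 (suc (suc i)) (s≤s z≤n) (s≤s (s≤s z≤n)) (s≤s i≤) r
pairAbove⁻ Q v (y ∷ W) t | inj₂ q with PairAbove-∷⁺ {x = y} (pairAbove⁻ Q v W q)
... | pairAt a b (s≤s _) a<b b≤ r = pairAt a b (s≤s z≤n) a<b b≤ r

pairAbove⁺ : ∀ Q v W → PairAbove Q v W 0 → T (pairAbove Q v W)
pairAbove⁺ Q v (y ∷ W) (pairAt 1 (suc (suc b)) _ _ (s≤s b≤) q) =
  T-∨ˡ {anyIn W (Q v y)} (anyIn-at⁺ W (Q v y) (suc b) (s≤s z≤n) b≤ q)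
pairAbove⁺ Q v (y ∷ W) (pairAt 1 1 _ (s≤s ()) _ _)
pairAbove⁺ Q v (y ∷ W) (pairAt (suc (suc a)) b _ a<b b≤ q) =
  T-∨ʳ {anyIn W (Q v y)} (pairAbove⁺ Q v W (PairAbove-∷⁻ (pairAt (suc (suc a)) b (s≤s (s≤s z≤n)) a<b b≤ q)))
pairAbove⁺ Q v [] (pairAt (suc a) (suc b) _ _ () _)

-- Scanning σ from the left, t is the minimum of an initial bound and the letters passed; started at
-- n ≥ every letter, t < σⱼ says exactly that some earlier letter is smaller.

SmallerBefore : ℕ → List ℕ → ℕ → Set
SmallerBefore t σ j = t < at σ j ⊎ (Σ ℕ λ i → 1 ≤ i × i < j × at σ i < at σ j)

module Scan (Q : Pattern) where

  matchesAt : ℕ → List ℕ → ℕ → Bool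
  matchesAt t []      j             = false
  matchesAt t (x ∷ U) zero          = false
  matchesAt t (x ∷ U) (suc zero)    = (t <ᵇ x) ∧ pairAbove Q x U
  matchesAt t (x ∷ U) (suc (suc j)) = matchesAt (t ⊓ x) U (suc j)

  matchCount : ℕ → List ℕ → ℕ
  matchCount t []      = 0
  matchCount t (x ∷ U) =
    if (t <ᵇ x) ∧ pairAbove Q x U then suc (matchCount (t ⊓ x) U) else matchCount (t ⊓ x) U

  matchesAt⁻ : ∀ t σ j → 1 ≤ j → j ≤ length σ → T (matchesAt t σ j) →
    SmallerBefore t σ j × PairAbove Q (at σ j) σ j
  matchesAt⁻ t (x ∷ U) (suc zero) _ _ h with T-∧⁻ {t <ᵇ x} h
  ... | t<x , p = inj₁ (<ᵇ⇒<′ t<x) , PairAbove-∷⁺ (pairAbove⁻ Q x U p)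
  matchesAt⁻ t (x ∷ U) (suc (suc j)) _ (s≤s j≤) h with matchesAt⁻ (t ⊓ x) U (suc j) (s≤s z≤n) j≤ h
  ... | sb , p = smaller sb , PairAbove-∷⁺ p
    where
    smaller : SmallerBefore (t ⊓ x) U (suc j) → SmallerBefore t (x ∷ U) (suc (suc j))
    smaller (inj₁ q) with ≤-total t x
    ... | inj₁ t≤x = inj₁ (subst (_< _) (m≤n⇒m⊓n≡m t≤x) q)
    ... | inj₂ x≤t = inj₂ (1 , ≤-refl , s≤s (s≤s z≤n) , subst (_< _) (m≥n⇒m⊓n≡n x≤t) q)
    smaller (inj₂ (suc i , _ , i<j , q)) = inj₂ (suc (suc i) , s≤s z≤n , s≤s i<j , q)

  matchesAt⁺ : ∀ t σ j → 1 ≤ j → j ≤ length σ →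
    SmallerBefore t σ j → PairAbove Q (at σ j) σ j → T (matchesAt t σ j)
  matchesAt⁺ t (x ∷ U) (suc zero) _ _ (inj₁ q) p =
    T-∧⁺ {t <ᵇ x} (<⇒<ᵇ q) (pairAbove⁺ Q x U (PairAbove-∷⁻ p))
  matchesAt⁺ t (x ∷ U) (suc zero) _ _ (inj₂ (i , 1≤i , i<1 , _)) p = ⊥-elim (<⇒≱ i<1 1≤i)
  matchesAt⁺ t (x ∷ U) (suc (suc j)) _ (s≤s j≤) sb p =
    matchesAt⁺ (t ⊓ x) U (suc j) (s≤s z≤n) j≤ (smaller sb) (PairAbove-∷⁻ p)
    where
    smaller : SmallerBefore t (x ∷ U) (suc (suc j)) → SmallerBefore (t ⊓ x) U (suc j)
    smaller (inj₁ q) = inj₁ (≤-<-trans (m⊓n≤m t x) q)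
    smaller (inj₂ (suc zero , _ , _ , q)) = inj₁ (≤-<-trans (m⊓n≤n t x) q)
    smaller (inj₂ (suc (suc i) , _ , s≤s i<j , q)) = inj₂ (suc i , s≤s z≤n , i<j , q)

  count-matchesAt : ∀ n t σ → length σ ≤ n → count (range 1 n) (matchesAt t σ) ≡ matchCount t σ
  count-matchesAt n t [] _ = count-false (range 1 n)
  count-matchesAt (suc n) t (x ∷ U) (s≤s U≤n) =
    ≡.trans (cong (λ r → count r (matchesAt t (x ∷ U))) (range-1-suc n)) head
    where
    shift : ∀ {j} → j ∈ range 1 n → matchesAt t (x ∷ U) (suc j) ≡ matchesAt (t ⊓ x) U j
    shift {zero} m with ∈-range⁻ {1} {n} m
    ... | () , _
    shift {suc j} m = refl
    tail : count (map suc (range 1 n)) (matchesAt t (x ∷ U)) ≡ matchCount (t ⊓ x) U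
    tail = ≡.trans (count-map suc (matchesAt t (x ∷ U)) (range 1 n))
             (≡.trans (count-cong (range 1 n) shift) (count-matchesAt n (t ⊓ x) U U≤n))
    head : count (1 ∷ map suc (range 1 n)) (matchesAt t (x ∷ U)) ≡ matchCount t (x ∷ U)
    head with (t <ᵇ x) ∧ pairAbove Q x U
    ... | true  = cong suc tail
    ... | false = tail

  matchAt≡matchesAt : ∀ n σ j → length σ ≡ n → (∀ i → at σ i ≤ n) → j ∈ range 1 n →
    matchAt Q n σ j ≡ matchesAt n σ j
  matchAt≡matchesAt n σ j refl σ≤n j∈ = T-ext to from
    where
    1≤j = proj₁ (∈-range⁻ {1} {n} j∈)
    j≤n = proj₂ (∈-range⁻ {1} {n} j∈)
    in-range : ∀ {x} → 1 ≤ x → x ≤ n → x ∈ range 1 n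
    in-range {suc x} _ x≤n = ∈-range⁺ {1} {n} {x} (s≤s z≤n) x≤n
    to : T (matchAt Q n σ j) → T (matchesAt n σ j)
    to h with anyIn⁻ (range 1 n) _ h
    ... | i , i∈ , h with anyIn⁻ (range 1 n) _ h
    ... | a , _ , h with anyIn⁻ (range 1 n) _ h
    ... | b , b∈ , h with T-∧⁻ {i <ᵇ j} h
    ... | i<j , h with T-∧⁻ {j <ᵇ a} h
    ... | j<a , h with T-∧⁻ {a <ᵇ b} h
    ... | a<b , h with T-∧⁻ {at σ i <ᵇ at σ j} h
    ... | σi<σj , q =
      matchesAt⁺ n σ j 1≤j j≤n
        (inj₂ (i , proj₁ (∈-range⁻ {1} {n} i∈) , <ᵇ⇒<′ i<j , <ᵇ⇒<′ σi<σj))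
        (pairAt a b (<ᵇ⇒<′ j<a) (<ᵇ⇒<′ a<b) (proj₂ (∈-range⁻ {1} {n} b∈)) q)
    from : T (matchesAt n σ j) → T (matchAt Q n σ j)
    from h with matchesAt⁻ n σ j 1≤j j≤n h
    ... | inj₁ n<σj , _ = ⊥-elim (<⇒≱ n<σj (σ≤n j))
    ... | inj₂ (i , 1≤i , i<j , σi<σj) , pairAt a b j<a a<b b≤n q =
      anyIn⁺ _ (in-range 1≤i (≤-trans (<⇒≤ i<j) j≤n))
        (anyIn⁺ _ (in-range 1≤a (≤-trans (<⇒≤ a<b) b≤n))
          (anyIn⁺ _ (in-range (≤-trans 1≤a (<⇒≤ a<b)) b≤n)
            (T-∧⁺ {i <ᵇ j} (<⇒<ᵇ i<j) (T-∧⁺ {j <ᵇ a} (<⇒<ᵇ j<a) (T-∧⁺ {a <ᵇ b} (<⇒<ᵇ a<b)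
              (T-∧⁺ {at σ i <ᵇ at σ j} (<⇒<ᵇ σi<σj) q))))))
      where
      1≤a : 1 ≤ a
      1≤a = ≤-trans 1≤j (<⇒≤ j<a)

  count-matchAt : ∀ n σ → length σ ≡ n → (∀ i → at σ i ≤ n) →
    count (range 1 n) (matchAt Q n σ) ≡ matchCount n σ
  count-matchAt n σ len σ≤n =
    ≡.trans (count-cong (range 1 n) (matchAt≡matchesAt n σ _ len σ≤n))
            (count-matchesAt n n σ (≤-reflexive len))

-- Relabelling letters

bump : ℕ → ℕ → ℕ
bump x y = if y <ᵇ x then y else suc y

unbump : ℕ → ℕ → ℕ
unbump x y = if y <ᵇ x then y else y ∸ 1

bump-< : ∀ {x y} → y < x → bump x y ≡ y
bump-< y<x rewrite <ᵇ-true y<x = refl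

bump-≥ : ∀ {x y} → x ≤ y → bump x y ≡ suc y
bump-≥ {x} {y} x≤y rewrite <ᵇ-false {y} {x} x≤y = refl

unbump-< : ∀ {x y} → y < x → unbump x y ≡ y
unbump-< y<x rewrite <ᵇ-true y<x = refl

unbump-≥ : ∀ {x y} → x ≤ y → unbump x y ≡ y ∸ 1
unbump-≥ {x} {y} x≤y rewrite <ᵇ-false {y} {x} x≤y = refl

unbump-bump : ∀ x y → unbump x (bump x y) ≡ y
unbump-bump x y with <-≤-connex y x
... | inj₁ y<x rewrite bump-< y<x = unbump-< y<x
... | inj₂ x≤y rewrite bump-≥ x≤y = unbump-≥ (m≤n⇒m≤1+n x≤y)

bump-unbump : ∀ x y → x ≢ y → bump x (unbump x y) ≡ y
bump-unbump x y x≢y with <-cmp y x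
... | tri< y<x _ _ rewrite unbump-< y<x = bump-< y<x
... | tri≈ _ y≡x _ = ⊥-elim (x≢y (sym y≡x))
bump-unbump x (suc y) x≢y | tri> _ _ x<y rewrite unbump-≥ (<⇒≤ x<y) = bump-≥ (s≤s⁻¹ x<y)

bump-injective : ∀ x {y z} → bump x y ≡ bump x z → y ≡ z
bump-injective x {y} {z} e = ≡.trans (sym (unbump-bump x y)) (≡.trans (cong (unbump x) e) (unbump-bump x z))

bump-≢ : ∀ x y → bump x y ≢ x
bump-≢ x y e with <-≤-connex y x
... | inj₁ y<x rewrite bump-< y<x = <-irrefl e y<x
... | inj₂ x≤y rewrite bump-≥ x≤y = <-irrefl (sym e) (s≤s x≤y)

bump-inflationary : ∀ x y → y ≤ bump x y
bump-inflationary x y with <-≤-connex y x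
... | inj₁ y<x rewrite bump-< y<x = ≤-refl
... | inj₂ x≤y rewrite bump-≥ x≤y = n≤1+n y

bump-≤ : ∀ x {y m} → y ≤ m → bump x y ≤ suc m
bump-≤ x {y} y≤m with <-≤-connex y x
... | inj₁ y<x rewrite bump-< y<x = m≤n⇒m≤1+n y≤m
... | inj₂ x≤y rewrite bump-≥ x≤y = s≤s y≤m

bump-<ᵇ-gap : ∀ x z → (bump x z <ᵇ x) ≡ (z <ᵇ x)
bump-<ᵇ-gap x z with <-≤-connex z x
... | inj₁ z<x rewrite bump-< z<x = refl
... | inj₂ x≤z rewrite bump-≥ x≤z | <ᵇ-false {z} {x} x≤z = <ᵇ-false (m≤n⇒m≤1+n x≤z)

<ᵇ-bump : ∀ p u y → (u <ᵇ bump (suc p) y) ≡ (unbump (suc p) u <ᵇ y)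
<ᵇ-bump p u y with <-≤-connex y (suc p) | <-≤-connex u (suc p)
... | inj₁ y<x | inj₁ u<x rewrite bump-< y<x | unbump-< u<x = refl
... | inj₁ y<x | inj₂ x≤u rewrite bump-< y<x | unbump-≥ x≤u =
  ≡.trans (<ᵇ-false (≤-trans (<⇒≤ y<x) x≤u))
          (sym (<ᵇ-false (≤-trans (s≤s⁻¹ y<x) (∸-monoˡ-≤ 1 x≤u))))
... | inj₂ x≤y | inj₁ u<x rewrite bump-≥ x≤y | unbump-< u<x =
  ≡.trans (<ᵇ-true (≤-trans u<x (m≤n⇒m≤1+n x≤y))) (sym (<ᵇ-true (<-≤-trans u<x x≤y)))
... | inj₂ x≤y | inj₂ (s≤s p≤u) rewrite bump-≥ x≤y | unbump-≥ (s≤s p≤u) = refl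

bump-<ᵇ-bump : ∀ x y z → (bump x y <ᵇ bump x z) ≡ (y <ᵇ z)
bump-<ᵇ-bump zero    y z = refl
bump-<ᵇ-bump (suc p) y z = ≡.trans (<ᵇ-bump p (bump (suc p) y) z) (cong (_<ᵇ z) (unbump-bump (suc p) y))

unbump-self : ∀ p → unbump (suc p) (suc p) ≡ p
unbump-self p = unbump-≥ {suc p} ≤-refl

unbump-⊓ : ∀ p t → unbump (suc p) (t ⊓ suc p) ≡ t ⊓ p
unbump-⊓ p t with <-≤-connex t (suc p)
... | inj₁ t<x rewrite m≤n⇒m⊓n≡m (<⇒≤ t<x) | unbump-< t<x | m≤n⇒m⊓n≡m (s≤s⁻¹ t<x) = refl
... | inj₂ x≤t rewrite m≥n⇒m⊓n≡n x≤t | unbump-self p | m≥n⇒m⊓n≡n (≤-trans (n≤1+n p) x≤t) = refl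

OrderPreserving : (ℕ → ℕ) → Set
OrderPreserving f = ∀ y z → (f y <ᵇ f z) ≡ (y <ᵇ z)

SameCuts : (ℕ → ℕ) → ℕ → ℕ → Set
SameCuts f u u' = ∀ y → (u <ᵇ f y) ≡ (u' <ᵇ y)

Invariant : Pattern → Set
Invariant Q = ∀ f u u' → OrderPreserving f → SameCuts f u u' → ∀ y z → Q u (f y) (f z) ≡ Q u' y z

rising-invariant : Invariant rising
rising-invariant f u u' mono cuts y z = cong₂ _∧_ (cuts y) (mono y z)

falling-invariant : Invariant falling
falling-invariant f u u' mono cuts y z = cong₂ _∧_ (cuts z) (mono z y)

SameCuts-⊓ : ∀ {f u u'} → OrderPreserving f → ∀ y → SameCuts f u u' → SameCuts f (u ⊓ f y) (u' ⊓ y)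
SameCuts-⊓ {f} {u} {u'} mono y cuts z =
  ≡.trans (⊓-<ᵇ u (f y) (f z)) (≡.trans (cong₂ _∨_ (cuts z) (mono y z)) (sym (⊓-<ᵇ u' y z)))

module _ {Q : Pattern} (inv : Invariant Q) {f : ℕ → ℕ} (mono : OrderPreserving f) where

  pairAbove-map : ∀ {u u'} W → SameCuts f u u' → pairAbove Q u (map f W) ≡ pairAbove Q u' W
  pairAbove-map [] cuts = refl
  pairAbove-map {u} {u'} (y ∷ W) cuts =
    cong₂ _∨_ (≡.trans (anyIn-map f W (Q u (f y))) (anyIn-cong W (inv f u u' mono cuts y)))
              (pairAbove-map W cuts)

  matchCount-map : ∀ {u u'} V → SameCuts f u u' → Scan.matchCount Q u (map f V) ≡ Scan.matchCount Q u' V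
  matchCount-map [] cuts = refl
  matchCount-map (y ∷ V) cuts =
    cong₂ (λ b r → if b then suc r else r)
      (cong₂ _∧_ (cuts y) (pairAbove-map V (mono y)))
      (matchCount-map V (SameCuts-⊓ {f} mono y cuts))

-- Codes

-- kᵢ ≤ n − i, and decode gives the permutation in which exactly kᵢ later letters exceed σᵢ.

IsCode : List ℕ → Set
IsCode []      = ⊤
IsCode (k ∷ c) = k ≤ length c × IsCode c

decode : List ℕ → List ℕ
decode []      = []
decode (k ∷ c) = suc (length c ∸ k) ∷ map (bump (suc (length c ∸ k))) (decode c)

length-decode : ∀ c → length (decode c) ≡ length c
length-decode []      = refl
length-decode (k ∷ c) = cong suc (≡.trans (length-map _ (decode c)) (length-decode c))

∈-decode⁻ : ∀ c {z} → z ∈ decode c → 1 ≤ z × z ≤ length c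
∈-decode⁻ (k ∷ c) (here refl) = s≤s z≤n , s≤s (m∸n≤m (length c) k)
∈-decode⁻ (k ∷ c) (there m) with ∈-map⁻ (bump (suc (length c ∸ k))) m
... | y , y∈ , refl with ∈-decode⁻ c y∈
...   | 1≤y , y≤ = ≤-trans 1≤y (bump-inflationary (suc (length c ∸ k)) y) , bump-≤ (suc (length c ∸ k)) y≤

∈-decode⁺ : ∀ c {z} → 1 ≤ z → z ≤ length c → z ∈ decode c
∈-decode⁺ []      (s≤s _) ()
∈-decode⁺ (k ∷ c) {z} 1≤z z≤ with <-cmp z (suc (length c ∸ k))
... | tri≈ _ z≡x _ = here z≡x
... | tri< z<x _ _ = there (subst (_∈ map (bump (suc (length c ∸ k))) (decode c)) (bump-< z<x)
        (∈-map⁺ _ (∈-decode⁺ c 1≤z (≤-trans (s≤s⁻¹ z<x) (m∸n≤m (length c) k)))))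
∈-decode⁺ (k ∷ c) {suc z} _ (s≤s z≤) | tri> _ _ x<z =
  there (subst (_∈ map (bump (suc (length c ∸ k))) (decode c)) (bump-≥ (s≤s⁻¹ x<z))
        (∈-map⁺ _ (∈-decode⁺ c (≤-trans (s≤s z≤n) (s≤s⁻¹ x<z)) z≤)))

decode-unique : ∀ c → Unique (decode c)
decode-unique []      = []
decode-unique (k ∷ c) =
  All.tabulate (λ m e → first∉ (subst (_∈ map (bump x) (decode c)) (sym e) m))
  ∷ map⁺ (bump-injective x) (decode-unique c)
  where
  x = suc (length c ∸ k)
  first∉ : x ∉ map (bump x) (decode c)
  first∉ m with ∈-map⁻ (bump x) m
  ... | y , _ , e = bump-≢ x y (sym e)

at-decode-≤ : ∀ c i → at (decode c) i ≤ length c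
at-decode-≤ c i = go (decode c) i (λ m → proj₂ (∈-decode⁻ c m))
  where
  go : ∀ σ i {m} → (∀ {z} → z ∈ σ → z ≤ m) → at σ i ≤ m
  go []      i             _ = z≤n
  go (x ∷ σ) zero          _ = z≤n
  go (x ∷ σ) (suc zero)    h = h (here refl)
  go (x ∷ σ) (suc (suc i)) h = go σ (suc i) (λ m → h (there m))

decode-injective : ∀ c₁ c₂ → IsCode c₁ → IsCode c₂ → decode c₁ ≡ decode c₂ → c₁ ≡ c₂
decode-injective []         []         _            _            _ = refl
decode-injective (k₁ ∷ c₁) (k₂ ∷ c₂) (k₁≤ , code₁) (k₂≤ , code₂) e =
  cong₂ _∷_ k₁≡k₂
    (decode-injective c₁ c₂ code₁ code₂ (map-injective (bump-injective (suc (length c₁ ∸ k₁))) tails≡))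
  where
  len≡ : length c₁ ≡ length c₂
  len≡ = suc-injective
    (≡.trans (sym (length-decode (k₁ ∷ c₁))) (≡.trans (cong length e) (length-decode (k₂ ∷ c₂))))
  heads≡ : suc (length c₁ ∸ k₁) ≡ suc (length c₂ ∸ k₂)
  heads≡ = proj₁ (∷-injective e)
  k₁≡k₂ : k₁ ≡ k₂
  k₁≡k₂ = ≡.trans (sym (m∸[m∸n]≡n k₁≤))
    (≡.trans (cong (length c₁ ∸_) (suc-injective (≡.trans heads≡ (cong (λ l → suc (l ∸ k₂)) (sym len≡)))))
             (m∸[m∸n]≡n (subst (k₂ ≤_) (sym len≡) k₂≤)))
  tails≡ : map (bump (suc (length c₁ ∸ k₁))) (decode c₁) ≡ map (bump (suc (length c₁ ∸ k₁))) (decode c₂)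
  tails≡ = ≡.trans (proj₂ (∷-injective e)) (cong (λ x → map (bump x) (decode c₂)) (sym heads≡))

Letter : ℕ → ℕ → Set
Letter n x = 1 ≤ x × x ≤ n

IsPermutation : ℕ → List ℕ → Set
IsPermutation n σ = length σ ≡ n × All (Letter n) σ × Unique σ

unique-map⁺ : {A B : Set} (f : A → B) {xs : List A} →
  (∀ {x y} → x ∈ xs → y ∈ xs → f x ≡ f y → x ≡ y) → Unique xs → Unique (map f xs)
unique-map⁺ f {[]}     _   _           = []
unique-map⁺ f {x ∷ xs} inj (x∉ ∷ uniq) =
  All.tabulate fx∉ ∷ unique-map⁺ f (λ p q → inj (there p) (there q)) uniq
  where
  fx∉ : ∀ {z} → z ∈ map f xs → f x ≢ z
  fx∉ m e with ∈-map⁻ f m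
  ... | y , y∈ , refl = All.lookup x∉ y∈ (inj (here refl) (there y∈) e)

decode-isPermutation : ∀ c → IsPermutation (length c) (decode c)
decode-isPermutation c = length-decode c , All.tabulate (∈-decode⁻ c) , decode-unique c

unbump-letter : ∀ {m x y} → Letter (suc m) x → Letter (suc m) y → x ≢ y → Letter m (unbump x y)
unbump-letter {m} {x} {y} (1≤x , x≤) (1≤y , y≤) x≢y with <-cmp y x
... | tri< y<x _ _ rewrite unbump-< y<x = 1≤y , s≤s⁻¹ (<-≤-trans y<x x≤)
... | tri≈ _ y≡x _ = ⊥-elim (x≢y (sym y≡x))
unbump-letter {m} {x} {suc y} (1≤x , _) (_ , s≤s y≤) _ | tri> _ _ x<y
  rewrite unbump-≥ (<⇒≤ x<y) = ≤-trans 1≤x (s≤s⁻¹ x<y) , y≤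

decode-surjective : ∀ n σ → IsPermutation n σ → Σ (List ℕ) λ c → (IsCode c × length c ≡ n) × decode c ≡ σ
decode-surjective zero [] _ = [] , (_ , refl) , refl
decode-surjective (suc m) (x ∷ U) (len , x-letter ∷ U-letters , x∉U ∷ U-unique)
  with decode-surjective m (map (unbump x) U) rest-isPermutation
  where
  rest-isPermutation : IsPermutation m (map (unbump x) U)
  rest-isPermutation =
    ≡.trans (length-map (unbump x) U) (suc-injective len) ,
    All.tabulate letter ,
    unique-map⁺ (unbump x) (λ p q e → ≡.trans (sym (bump-unbump x _ (All.lookup x∉U p)))
                                        (≡.trans (cong (bump x) e) (bump-unbump x _ (All.lookup x∉U q)))) U-unique
    where
    letter : ∀ {y'} → y' ∈ map (unbump x) U → Letter m y'
    letter y'∈ with ∈-map⁻ (unbump x) y'∈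
    ... | y , y∈ , refl = unbump-letter x-letter (All.lookup U-letters y∈) (All.lookup x∉U y∈)
... | c , (code , c-len) , decode-c =
  (m ∸ (x ∸ 1)) ∷ c , ((subst (m ∸ (x ∸ 1) ≤_) (sym c-len) (m∸n≤m m (x ∸ 1)) , code) , cong suc c-len) ,
  cong₂ _∷_ head≡ (≡.trans (cong (λ z → map (bump z) (decode c)) head≡)
                    (≡.trans (cong (map (bump x)) decode-c) (bump-unbump-all U x∉U)))
  where
  head≡ : suc (length c ∸ (m ∸ (x ∸ 1))) ≡ x
  head≡ rewrite c-len | m∸[m∸n]≡n (∸-monoˡ-≤ 1 (proj₂ x-letter)) = suc-∸1 x (proj₁ x-letter)
    where
    suc-∸1 : ∀ x → 1 ≤ x → suc (x ∸ 1) ≡ x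
    suc-∸1 (suc x) _ = refl
  bump-unbump-all : ∀ V → All (x ≢_) V → map (bump x) (map (unbump x) V) ≡ V
  bump-unbump-all []      _          = refl
  bump-unbump-all (y ∷ V) (x≢y ∷ ne) = cong₂ _∷_ (bump-unbump x y x≢y) (bump-unbump-all V ne)

consAll : {A : Set} → List A → List (List A) → List (List A)
consAll as ws = concatMap (λ w → map (_∷ w) as) ws

∈-consAll⁻ : {A : Set} (as : List A) (ws : List (List A)) {v : List A} → v ∈ consAll as ws →
  Σ A λ a → Σ (List A) λ w → a ∈ as × w ∈ ws × v ≡ a ∷ w
∈-consAll⁻ as ws v∈ with find (∈-concatMap⁻ (λ w → map (_∷ w) as) {xs = ws} v∈)
... | w , w∈ , v∈' with ∈-map⁻ (_∷ w) v∈'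
...   | a , a∈ , refl = a , w , a∈ , w∈ , refl

∈-consAll⁺ : {A : Set} {as : List A} (ws : List (List A)) {a : A} {w : List A} →
  a ∈ as → w ∈ ws → a ∷ w ∈ consAll as ws
∈-consAll⁺ {as = as} ws {w = w} a∈ w∈ =
  ∈-concatMap⁺ (λ w → map (_∷ w) as) {xs = ws} (lose w∈ (∈-map⁺ (_∷ w) a∈))

consAll-unique : {A : Set} {as : List A} {ws : List (List A)} → Unique as → Unique ws → Unique (consAll as ws)
consAll-unique {ws = []}     _       _                = []
consAll-unique {as = as} {ws = w ∷ ws} as-unique (w∉ ∷ ws-unique) =
  ++⁺ (map⁺ (λ e → proj₁ (∷-injective e)) as-unique) (consAll-unique as-unique ws-unique) disjoint
  where
  disjoint : ∀ {v} → v ∈ map (_∷ w) as × v ∈ consAll as ws → ⊥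
  disjoint (v∈ , v∈') with ∈-map⁻ (_∷ w) v∈ | ∈-consAll⁻ as ws v∈'
  ... | _ , _ , refl | _ , w' , _ , w'∈ , e = All.lookup w∉ w'∈ (proj₂ (∷-injective e))

codes : ℕ → List (List ℕ)
codes zero    = [] ∷ []
codes (suc n) = consAll (upTo (suc n)) (codes n)

∈-codes⁻ : ∀ n {c} → c ∈ codes n → IsCode c × length c ≡ n
∈-codes⁻ zero    (here refl) = _ , refl
∈-codes⁻ (suc n) c∈ with ∈-consAll⁻ (upTo (suc n)) (codes n) c∈
... | k , c , k∈ , c∈' , refl with ∈-codes⁻ n c∈'
...   | code , refl = (s≤s⁻¹ (∈-upTo⁻ k∈) , code) , refl

∈-codes⁺ : ∀ c → IsCode c → c ∈ codes (length c)
∈-codes⁺ []      _          = here refl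
∈-codes⁺ (k ∷ c) (k≤ , code) = ∈-consAll⁺ (codes (length c)) (∈-upTo⁺ (s≤s k≤)) (∈-codes⁺ c code)

codes-unique : ∀ n → Unique (codes n)
codes-unique zero    = [] ∷ []
codes-unique (suc n) = consAll-unique (upTo⁺ (suc n)) (codes-unique n)

∈-words⁻ : ∀ n k {w} → w ∈ words n k → length w ≡ k × All (Letter n) w
∈-words⁻ n zero    (here refl) = refl , []
∈-words⁻ n (suc k) w∈ with ∈-consAll⁻ (range 1 n) (words n k) w∈
... | x , w , x∈ , w∈ , refl with ∈-words⁻ n k w∈
...   | refl , letters = refl , ∈-range⁻ {1} {n} x∈ ∷ letters

∈-words⁺ : ∀ n w → All (Letter n) w → w ∈ words n (length w)
∈-words⁺ n []      _                     = here refl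
∈-words⁺ n (suc x ∷ w) ((_ , x≤) ∷ letters) =
  ∈-consAll⁺ (words n (length w)) (∈-range⁺ {1} {n} {x} (s≤s z≤n) x≤) (∈-words⁺ n w letters)

words-unique : ∀ n k → Unique (words n k)
words-unique n zero    = [] ∷ []
words-unique n (suc k) =
  consAll-unique (subst Unique (sym (range-1 n)) (map⁺ suc-injective (upTo⁺ n))) (words-unique n k)

∈-Sym⁻ : ∀ n {σ} → σ ∈ Sym n → IsPermutation n σ
∈-Sym⁻ n σ∈ with ∈-filter⁻ (UniqueDec.unique? _≟_) {xs = words n n} σ∈
... | σ∈' , σ-unique with ∈-words⁻ n n σ∈'
...   | len , letters = len , letters , σ-unique

∈-Sym⁺ : ∀ n {σ} → IsPermutation n σ → σ ∈ Sym n
∈-Sym⁺ n {σ} (refl , letters , σ-unique) = ∈-filter⁺ (UniqueDec.unique? _≟_) (∈-words⁺ n σ letters) σ-unique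

Sym-unique : ∀ n → Unique (Sym n)
Sym-unique n = filter⁺ (UniqueDec.unique? _≟_) (words-unique n n)

↭-unique : {A : Set} {xs ys : List A} → Unique xs → Unique ys →
  (∀ {x} → x ∈ xs → x ∈ ys) → (∀ {x} → x ∈ ys → x ∈ xs) → xs ↭ ys
↭-unique xs-unique ys-unique to from = ∼bag⇒↭ (unique∧set⇒bag xs-unique ys-unique (mk⇔ to from))

decode-codes↭Sym : ∀ n → map decode (codes n) ↭ Sym n
decode-codes↭Sym n = ↭-unique (unique-map⁺ decode injective (codes-unique n)) (Sym-unique n) to from
  where
  injective : ∀ {x y} → x ∈ codes n → y ∈ codes n → decode x ≡ decode y → x ≡ y
  injective x∈ y∈ = decode-injective _ _ (proj₁ (∈-codes⁻ n x∈)) (proj₁ (∈-codes⁻ n y∈))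
  to : ∀ {σ} → σ ∈ map decode (codes n) → σ ∈ Sym n
  to σ∈ with ∈-map⁻ decode σ∈
  ... | c , c∈ , refl with ∈-codes⁻ n c∈
  ...   | _ , refl = ∈-Sym⁺ (length c) (decode-isPermutation c)
  from : ∀ {σ} → σ ∈ Sym n → σ ∈ map decode (codes n)
  from σ∈ with decode-surjective n _ (∈-Sym⁻ n σ∈)
  ... | c , (code , refl) , refl = ∈-map⁺ decode (∈-codes⁺ c code)

-- Matches counted on codes

riseStep : ℕ → ℕ → ℕ
riseStep zero    d = suc d
riseStep (suc k) d = if d <ᵇ suc k then d else suc k

fallStep : ℕ → ℕ → ℕ
fallStep zero    e = 1
fallStep (suc k) e = if e <ᵇ suc k then e else suc (suc k)

-- length c ∸ riseGap c is the largest letter of decode c followed by a larger one, and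
-- length c ∸ fallGap c the largest letter of decode c preceded by a larger one (0 if none).

riseGap : List ℕ → ℕ
riseGap []      = 0
riseGap (k ∷ c) = riseStep k (riseGap c)

fallGap : List ℕ → ℕ
fallGap []      = 0
fallGap (k ∷ c) = fallStep k (fallGap c)

k<1+m∸v : ∀ m k v → k ≤ m → v ≤ m ∸ k → suc k ≤ suc m ∸ v
k<1+m∸v m k v k≤m v≤ = subst (_≤ suc m ∸ v) 1+m∸[m∸k]≡1+k (∸-monoʳ-≤ (suc m) v≤)
  where
  1+m∸[m∸k]≡1+k : suc m ∸ (m ∸ k) ≡ suc k
  1+m∸[m∸k]≡1+k = ≡.trans (+-∸-assoc 1 (m∸n≤m m k)) (cong suc (m∸[m∸n]≡n k≤m))

1+m∸v≤k : ∀ m k v → k ≤ m → suc (m ∸ k) ≤ v → suc m ∸ v ≤ k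
1+m∸v≤k m k v k≤m v≤ = subst (suc m ∸ v ≤_) (m∸[m∸n]≡n k≤m) (∸-monoʳ-≤ (suc m) v≤)

riseStep-≤ : ∀ k d → 0 < k → riseStep k d ≤ k
riseStep-≤ (suc k) d _ with <-≤-connex d (suc k)
... | inj₁ d<k rewrite <ᵇ-true d<k = <⇒≤ d<k
... | inj₂ k≤d rewrite <ᵇ-false {d} {suc k} k≤d = ≤-refl

riseStep-threshold : ∀ m k d v → k ≤ m →
  ((v <ᵇ suc (m ∸ k)) ∧ ((m ∸ k) <ᵇ m)) ∨ (d <ᵇ m ∸ unbump (suc (m ∸ k)) v)
    ≡ (riseStep k d <ᵇ suc m ∸ v)
riseStep-threshold m k d v k≤m with <-≤-connex v (suc (m ∸ k))
riseStep-threshold m zero d v k≤m | inj₁ v<x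
  rewrite unbump-< v<x | <ᵇ-true v<x | <ᵇ-false {m} {m} ≤-refl | +-∸-assoc 1 {m} {v} (s≤s⁻¹ v<x) = refl
riseStep-threshold m (suc k) d v k≤m | inj₁ v<x
  rewrite unbump-< v<x | <ᵇ-true v<x | <ᵇ-true {m ∸ suc k} {m} (∸-monoʳ-< {m} {suc k} {0} (s≤s z≤n) k≤m)
  = sym (<ᵇ-true (<-≤-trans (s≤s (riseStep-≤ (suc k) d (s≤s z≤n))) (k<1+m∸v m (suc k) v k≤m (s≤s⁻¹ v<x))))
riseStep-threshold m k d zero k≤m | inj₂ ()
riseStep-threshold m zero d (suc v) k≤m | inj₂ x≤v rewrite unbump-≥ x≤v | <ᵇ-false {suc v} {suc (m ∸ 0)} x≤v
  | n≤0⇒n≡0 (1+m∸v≤k m 0 (suc v) k≤m x≤v) = refl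
riseStep-threshold m (suc k) d (suc v) k≤m | inj₂ x≤v
  rewrite unbump-≥ x≤v | <ᵇ-false {suc v} {suc (m ∸ suc k)} x≤v
  with <-≤-connex d (suc k)
... | inj₁ d<k rewrite <ᵇ-true d<k = refl
... | inj₂ k≤d rewrite <ᵇ-false {d} {suc k} k≤d =
  ≡.trans (<ᵇ-false (≤-trans 1+m∸v≤k' k≤d)) (sym (<ᵇ-false 1+m∸v≤k'))
  where
  1+m∸v≤k' : suc m ∸ suc v ≤ suc k
  1+m∸v≤k' = 1+m∸v≤k m (suc k) (suc v) k≤m x≤v

fallStep-threshold : ∀ m k e v → k ≤ m →
  ((suc (unbump (suc (m ∸ k)) v) <ᵇ suc (m ∸ k)) ∧ (unbump (suc (m ∸ k)) v <ᵇ m))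
    ∨ (e <ᵇ m ∸ unbump (suc (m ∸ k)) v)
    ≡ (fallStep k e <ᵇ suc m ∸ v)
fallStep-threshold m k e v k≤m with <-≤-connex v (suc (m ∸ k))
fallStep-threshold m k e zero k≤m | inj₂ ()
fallStep-threshold m zero e v k≤m | inj₁ v<x rewrite unbump-< v<x | +-∸-assoc 1 {m} {v} (s≤s⁻¹ v<x) with <-cmp v m
... | tri< v<m _ _ rewrite <ᵇ-true v<m | <ᵇ-true {0} {m ∸ v} (m<n⇒0<n∸m v<m) = refl
... | tri≈ _ refl _ rewrite <ᵇ-false {v} {v} ≤-refl | n∸n≡0 v = refl
... | tri> _ _ v>m = ⊥-elim (<⇒≱ v>m (s≤s⁻¹ v<x))
fallStep-threshold m (suc k) e v k≤m | inj₁ v<x rewrite unbump-< v<x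
  | +-∸-assoc 1 {m} {v} (≤-trans (s≤s⁻¹ v<x) (m∸n≤m m (suc k))) with <-cmp v (m ∸ suc k)
... | tri< v<p _ _ rewrite <ᵇ-true v<p | <ᵇ-true (<-≤-trans v<p (m∸n≤m m (suc k))) = sym (<ᵇ-true fallStep<)
  where
  k+1<1+m∸v : suc (suc k) ≤ suc m ∸ suc v
  k+1<1+m∸v = k<1+m∸v m (suc k) (suc v) k≤m v<p
  fallStep< : fallStep (suc k) e < suc (m ∸ v)
  fallStep< with <-≤-connex e (suc k)
  ... | inj₁ e<k rewrite <ᵇ-true e<k = ≤-trans e<k (≤-trans (n≤1+n (suc k)) (≤-trans k+1<1+m∸v (n≤1+n _)))
  ... | inj₂ k≤e rewrite <ᵇ-false {e} {suc k} k≤e = s≤s k+1<1+m∸v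
... | tri≈ _ refl _ rewrite <ᵇ-false {m ∸ suc k} {m ∸ suc k} ≤-refl | m∸[m∸n]≡n k≤m with <-≤-connex e (suc k)
...   | inj₁ e<k rewrite <ᵇ-true e<k | <ᵇ-true (≤-trans e<k (n≤1+n (suc k))) = refl
...   | inj₂ k≤e rewrite <ᵇ-false {e} {suc k} k≤e | <ᵇ-false {suc (suc k)} {suc (suc k)} ≤-refl = refl
fallStep-threshold m (suc k) e v k≤m | inj₁ v<x | tri> _ _ v>p = ⊥-elim (<⇒≱ v>p (s≤s⁻¹ v<x))
fallStep-threshold m zero e (suc v) k≤m | inj₂ x≤v rewrite unbump-≥ x≤v | <ᵇ-false {suc v} {suc m} x≤v
  | n≤0⇒n≡0 (1+m∸v≤k m 0 (suc v) k≤m x≤v) = refl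
fallStep-threshold m (suc k) e (suc v) k≤m | inj₂ x≤v
  rewrite unbump-≥ x≤v | <ᵇ-false {suc v} {suc (m ∸ suc k)} x≤v
  with <-≤-connex e (suc k)
... | inj₁ e<k rewrite <ᵇ-true e<k = refl
... | inj₂ k≤e rewrite <ᵇ-false {e} {suc k} k≤e =
  ≡.trans (<ᵇ-false (≤-trans 1+m∸v≤k' k≤e)) (sym (<ᵇ-false (≤-trans 1+m∸v≤k' (n≤1+n _))))
  where
  1+m∸v≤k' : suc m ∸ suc v ≤ suc k
  1+m∸v≤k' = 1+m∸v≤k m (suc k) (suc v) k≤m x≤v

anyIn-decode-> : ∀ c u → anyIn (decode c) (u <ᵇ_) ≡ (u <ᵇ length c)
anyIn-decode-> c u = T-ext to from
  where
  to : T (anyIn (decode c) (u <ᵇ_)) → T (u <ᵇ length c)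
  to h with anyIn⁻ (decode c) _ h
  ... | z , z∈ , u<z = <⇒<ᵇ (<-≤-trans (<ᵇ⇒<′ {u} u<z) (proj₂ (∈-decode⁻ c z∈)))
  from : T (u <ᵇ length c) → T (anyIn (decode c) (u <ᵇ_))
  from h = anyIn⁺ (u <ᵇ_) (∈-decode⁺ c (≤-trans (s≤s z≤n) (<ᵇ⇒<′ {u} h)) ≤-refl) h

anyIn-decode-between : ∀ c a b →
  anyIn (decode c) (λ z → (a <ᵇ z) ∧ (z <ᵇ b)) ≡ (suc a <ᵇ b) ∧ (a <ᵇ length c)
anyIn-decode-between c a b = T-ext to from
  where
  to : T (anyIn (decode c) (λ z → (a <ᵇ z) ∧ (z <ᵇ b))) → T ((suc a <ᵇ b) ∧ (a <ᵇ length c))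
  to h with anyIn⁻ (decode c) _ h
  ... | z , z∈ , q with T-∧⁻ {a <ᵇ z} q
  ... | a<z , z<b = T-∧⁺ {suc a <ᵇ b} (<⇒<ᵇ (<-≤-trans (s≤s (<ᵇ⇒<′ {a} a<z)) (<ᵇ⇒<′ {z} {b} z<b)))
                      (<⇒<ᵇ (<-≤-trans (<ᵇ⇒<′ {a} a<z) (proj₂ (∈-decode⁻ c z∈))))
  from : T ((suc a <ᵇ b) ∧ (a <ᵇ length c)) → T (anyIn (decode c) (λ z → (a <ᵇ z) ∧ (z <ᵇ b)))
  from h with T-∧⁻ {suc a <ᵇ b} h
  ... | a+1<b , a<len = anyIn⁺ (λ z → (a <ᵇ z) ∧ (z <ᵇ b)) (∈-decode⁺ c (s≤s z≤n) (<ᵇ⇒<′ {a} a<len))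
                          (T-∧⁺ {a <ᵇ suc a} (<⇒<ᵇ (n<1+n a)) a+1<b)

pairAbove-rising-decode : ∀ c → IsCode c → ∀ v → pairAbove rising v (decode c) ≡ (riseGap c <ᵇ length c ∸ v)
pairAbove-rising-decode []      _          v rewrite 0∸n≡0 v = refl
pairAbove-rising-decode (k ∷ c) (k≤ , code) v =
  ≡.trans (cong₂ _∨_ first rest) (riseStep-threshold (length c) k (riseGap c) v k≤)
  where
  p = length c ∸ k
  first : anyIn (map (bump (suc p)) (decode c)) (rising v (suc p)) ≡ (v <ᵇ suc p) ∧ (p <ᵇ length c)
  first = ≡.trans (anyIn-∧ˡ (map (bump (suc p)) (decode c)) (v <ᵇ suc p) (suc p <ᵇ_))
    (cong ((v <ᵇ suc p) ∧_)
      (≡.trans (anyIn-map (bump (suc p)) (decode c) (suc p <ᵇ_))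
        (≡.trans (anyIn-cong (decode c) (λ z → ≡.trans (<ᵇ-bump p (suc p) z) (cong (_<ᵇ z) (unbump-self p))))
                 (anyIn-decode-> c p))))
  rest : pairAbove rising v (map (bump (suc p)) (decode c)) ≡ (riseGap c <ᵇ length c ∸ unbump (suc p) v)
  rest = ≡.trans (pairAbove-map rising-invariant (bump-<ᵇ-bump (suc p)) (decode c) (<ᵇ-bump p v))
                 (pairAbove-rising-decode c code (unbump (suc p) v))

pairAbove-falling-decode : ∀ c → IsCode c → ∀ v → pairAbove falling v (decode c) ≡ (fallGap c <ᵇ length c ∸ v)
pairAbove-falling-decode []      _          v rewrite 0∸n≡0 v = refl
pairAbove-falling-decode (k ∷ c) (k≤ , code) v =
  ≡.trans (cong₂ _∨_ first rest) (fallStep-threshold (length c) k (fallGap c) v k≤)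
  where
  p = length c ∸ k
  first : anyIn (map (bump (suc p)) (decode c)) (falling v (suc p))
        ≡ (suc (unbump (suc p) v) <ᵇ suc p) ∧ (unbump (suc p) v <ᵇ length c)
  first = ≡.trans (anyIn-map (bump (suc p)) (decode c) (falling v (suc p)))
    (≡.trans (anyIn-cong (decode c) (λ z → cong₂ _∧_ (<ᵇ-bump p v z) (bump-<ᵇ-gap (suc p) z)))
             (anyIn-decode-between c (unbump (suc p) v) (suc p)))
  rest : pairAbove falling v (map (bump (suc p)) (decode c)) ≡ (fallGap c <ᵇ length c ∸ unbump (suc p) v)
  rest = ≡.trans (pairAbove-map falling-invariant (bump-<ᵇ-bump (suc p)) (decode c) (<ᵇ-bump p v))
                 (pairAbove-falling-decode c code (unbump (suc p) v))

SameCuts-bump : ∀ p {u u'} → unbump (suc p) u ≡ u' → SameCuts (bump (suc p)) u u'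
SameCuts-bump p {u} refl = <ᵇ-bump p u

codeMatchCount : (List ℕ → ℕ) → ℕ → List ℕ → ℕ
codeMatchCount gap t []      = 0
codeMatchCount gap t (k ∷ c) =
  if (t <ᵇ suc (length c ∸ k)) ∧ (gap c <ᵇ k)
  then suc (codeMatchCount gap (t ⊓ (length c ∸ k)) c)
  else codeMatchCount gap (t ⊓ (length c ∸ k)) c

matchCount-decode : ∀ {Q} → Invariant Q → (gap : List ℕ → ℕ) →
  (∀ c → IsCode c → ∀ v → pairAbove Q v (decode c) ≡ (gap c <ᵇ length c ∸ v)) →
  ∀ c → IsCode c → ∀ t → Scan.matchCount Q t (decode c) ≡ codeMatchCount gap t c
matchCount-decode inv gap pairAbove-decode []      _          t = refl
matchCount-decode {Q} inv gap pairAbove-decode (k ∷ c) (k≤ , code) t =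
  cong₂ (λ b r → if (t <ᵇ suc p) ∧ b then suc r else r) later-pair rest
  where
  p = length c ∸ k
  later-pair : pairAbove Q (suc p) (map (bump (suc p)) (decode c)) ≡ (gap c <ᵇ k)
  later-pair =
    ≡.trans (pairAbove-map inv (bump-<ᵇ-bump (suc p)) (decode c) (SameCuts-bump p (unbump-self p)))
      (≡.trans (pairAbove-decode c code p) (cong (gap c <ᵇ_) (m∸[m∸n]≡n k≤)))
  rest : Scan.matchCount Q (t ⊓ suc p) (map (bump (suc p)) (decode c)) ≡ codeMatchCount gap (t ⊓ p) c
  rest =
    ≡.trans (matchCount-map inv (bump-<ᵇ-bump (suc p)) (decode c) (SameCuts-bump p (unbump-⊓ p t)))
      (matchCount-decode inv gap pairAbove-decode c code (t ⊓ p))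

-- The bijection ψ

ψstep : ℕ → ℕ → ℕ
ψstep zero d = d
ψstep (suc k) d = if d <ᵇ suc k then suc k else k

ψ : List ℕ → List ℕ
ψ [] = []
ψ (k ∷ c) = ψstep k (riseGap c) ∷ ψ c

ψ⁻¹step : ℕ → ℕ → ℕ
ψ⁻¹step k e = if e <ᵇ k then k else (if k ≡ᵇ e then 0 else suc k)

ψ⁻¹ : List ℕ → List ℕ
ψ⁻¹ [] = []
ψ⁻¹ (k ∷ c) = ψ⁻¹step k (fallGap c) ∷ ψ⁻¹ c

length-ψ : ∀ c → length (ψ c) ≡ length c
length-ψ [] = refl
length-ψ (k ∷ c) = cong suc (length-ψ c)

length-ψ⁻¹ : ∀ c → length (ψ⁻¹ c) ≡ length c
length-ψ⁻¹ [] = refl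
length-ψ⁻¹ (k ∷ c) = cong suc (length-ψ⁻¹ c)

fallStep-ψstep : ∀ k d → fallStep (ψstep k d) d ≡ riseStep k d
fallStep-ψstep zero    zero    = refl
fallStep-ψstep zero    (suc d) rewrite <ᵇ-irrefl d = refl
fallStep-ψstep (suc k) d with <-≤-connex d (suc k)
... | inj₁ d<k rewrite <ᵇ-true d<k | <ᵇ-true d<k = refl
... | inj₂ k≤d rewrite <ᵇ-false {d} {suc k} k≤d = fallStep-below k k≤d
  where
  fallStep-below : ∀ k → suc k ≤ d → fallStep k d ≡ suc k
  fallStep-below zero    _   = refl
  fallStep-below (suc k) k<d rewrite <ᵇ-false {d} {suc k} (≤-trans (n≤1+n (suc k)) k<d) = refl

fallGap-ψ : ∀ c → fallGap (ψ c) ≡ riseGap c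
fallGap-ψ []      = refl
fallGap-ψ (k ∷ c) rewrite fallGap-ψ c = fallStep-ψstep k (riseGap c)

riseStep-ψ⁻¹step : ∀ k e → riseStep (ψ⁻¹step k e) e ≡ fallStep k e
riseStep-ψ⁻¹step k e with <-≤-connex e k
... | inj₁ e<k rewrite <ᵇ-true e<k = above k e<k
  where
  above : ∀ k → e < k → riseStep k e ≡ fallStep k e
  above (suc k) e<k rewrite <ᵇ-true e<k = refl
... | inj₂ k≤e rewrite <ᵇ-false {e} {k} k≤e with k ≟ e
...   | yes refl rewrite ≡ᵇ-refl k = at-equal k
  where
  at-equal : ∀ k → riseStep 0 k ≡ fallStep k k
  at-equal zero    = refl
  at-equal (suc k) rewrite <ᵇ-irrefl k = refl
...   | no k≢e rewrite ≡ᵇ-false k≢e = below k (≤∧≢⇒< k≤e k≢e)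
  where
  below : ∀ k → k < e → riseStep (suc k) e ≡ fallStep k e
  below zero    k<e rewrite <ᵇ-false {e} {1} k<e = refl
  below (suc k) k<e rewrite <ᵇ-false {e} {suc (suc k)} k<e | <ᵇ-false {e} {suc k} (<⇒≤ k<e) = refl

riseGap-ψ⁻¹ : ∀ c → riseGap (ψ⁻¹ c) ≡ fallGap c
riseGap-ψ⁻¹ []      = refl
riseGap-ψ⁻¹ (k ∷ c) rewrite riseGap-ψ⁻¹ c = riseStep-ψ⁻¹step k (fallGap c)

ψ⁻¹step-ψstep : ∀ k d → ψ⁻¹step (ψstep k d) d ≡ k
ψ⁻¹step-ψstep zero    d rewrite <ᵇ-irrefl d | ≡ᵇ-refl d = refl
ψ⁻¹step-ψstep (suc k) d with <-≤-connex d (suc k)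
... | inj₁ d<k rewrite <ᵇ-true d<k | <ᵇ-true d<k = refl
... | inj₂ k<d rewrite <ᵇ-false {d} {suc k} k<d | <ᵇ-false {d} {k} (≤-trans (n≤1+n k) k<d)
      | ≡ᵇ-false {k} {d} (λ k≡d → <-irrefl k≡d k<d) = refl

ψstep-ψ⁻¹step : ∀ k e → ψstep (ψ⁻¹step k e) e ≡ k
ψstep-ψ⁻¹step k e with <-≤-connex e k
... | inj₁ e<k rewrite <ᵇ-true e<k = above k e<k
  where
  above : ∀ k → e < k → ψstep k e ≡ k
  above (suc k) e<k rewrite <ᵇ-true e<k = refl
... | inj₂ k≤e rewrite <ᵇ-false {e} {k} k≤e with k ≟ e
...   | yes refl rewrite ≡ᵇ-refl k = refl
...   | no k≢e rewrite ≡ᵇ-false k≢e | <ᵇ-false {e} {suc k} (≤∧≢⇒< k≤e k≢e) = refl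

ψ⁻¹-ψ : ∀ c → ψ⁻¹ (ψ c) ≡ c
ψ⁻¹-ψ []      = refl
ψ⁻¹-ψ (k ∷ c) rewrite fallGap-ψ c | ψ⁻¹-ψ c = cong (_∷ c) (ψ⁻¹step-ψstep k (riseGap c))

ψ-ψ⁻¹ : ∀ c → ψ (ψ⁻¹ c) ≡ c
ψ-ψ⁻¹ []      = refl
ψ-ψ⁻¹ (k ∷ c) rewrite riseGap-ψ⁻¹ c | ψ-ψ⁻¹ c = cong (_∷ c) (ψstep-ψ⁻¹step k (fallGap c))

riseGap-≤ : ∀ c → IsCode c → riseGap c ≤ length c
riseGap-≤ []          _          = z≤n
riseGap-≤ (zero ∷ c)  (_ , code) = s≤s (riseGap-≤ c code)
riseGap-≤ (suc k ∷ c) (k<n , code) with <-≤-connex (riseGap c) (suc k)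
... | inj₁ d<k rewrite <ᵇ-true d<k = m≤n⇒m≤1+n (riseGap-≤ c code)
... | inj₂ k≤d rewrite <ᵇ-false {riseGap c} {suc k} k≤d = m≤n⇒m≤1+n k<n

fallGap-≤ : ∀ c → IsCode c → fallGap c ≤ length c
fallGap-≤ []          _          = z≤n
fallGap-≤ (zero ∷ c)  _          = s≤s z≤n
fallGap-≤ (suc k ∷ c) (k<n , code) with <-≤-connex (fallGap c) (suc k)
... | inj₁ e<k rewrite <ᵇ-true e<k = m≤n⇒m≤1+n (fallGap-≤ c code)
... | inj₂ k≤e rewrite <ᵇ-false {fallGap c} {suc k} k≤e = s≤s k<n

IsCode-ψ : ∀ c → IsCode c → IsCode (ψ c)
IsCode-ψ []      _          = _
IsCode-ψ (k ∷ c) (k≤ , code) =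
  subst (ψstep k (riseGap c) ≤_) (sym (length-ψ c)) (ψstep-≤ k k≤) , IsCode-ψ c code
  where
  ψstep-≤ : ∀ k → k ≤ length c → ψstep k (riseGap c) ≤ length c
  ψstep-≤ zero    _  = riseGap-≤ c code
  ψstep-≤ (suc k) k< with <-≤-connex (riseGap c) (suc k)
  ... | inj₁ d<k rewrite <ᵇ-true d<k = k<
  ... | inj₂ k≤d rewrite <ᵇ-false {riseGap c} {suc k} k≤d = ≤-trans (n≤1+n k) k<

IsCode-ψ⁻¹ : ∀ c → IsCode c → IsCode (ψ⁻¹ c)
IsCode-ψ⁻¹ []      _          = _
IsCode-ψ⁻¹ (k ∷ c) (k≤ , code) =
  subst (ψ⁻¹step k (fallGap c) ≤_) (sym (length-ψ⁻¹ c)) ψ⁻¹step-≤ , IsCode-ψ⁻¹ c code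
  where
  ψ⁻¹step-≤ : ψ⁻¹step k (fallGap c) ≤ length c
  ψ⁻¹step-≤ with <-≤-connex (fallGap c) k
  ... | inj₁ e<k rewrite <ᵇ-true e<k = k≤
  ... | inj₂ k≤e rewrite <ᵇ-false {fallGap c} {k} k≤e with k ≟ fallGap c
  ...   | yes refl rewrite ≡ᵇ-refl k = z≤n
  ...   | no k≢e rewrite ≡ᵇ-false k≢e = ≤-trans (≤∧≢⇒< k≤e k≢e) (fallGap-≤ c code)

ψ-codes↭codes : ∀ n → map ψ (codes n) ↭ codes n
ψ-codes↭codes n = ↭-unique (unique-map⁺ ψ injective (codes-unique n)) (codes-unique n) to from
  where
  injective : ∀ {x y} → x ∈ codes n → y ∈ codes n → ψ x ≡ ψ y → x ≡ y
  injective {x} {y} _ _ e = ≡.trans (sym (ψ⁻¹-ψ x)) (≡.trans (cong ψ⁻¹ e) (ψ⁻¹-ψ y))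
  to : ∀ {c} → c ∈ map ψ (codes n) → c ∈ codes n
  to c∈ with ∈-map⁻ ψ c∈
  ... | c , c∈' , refl with ∈-codes⁻ n c∈'
  ...   | code , refl = subst (λ l → ψ c ∈ codes l) (length-ψ c) (∈-codes⁺ (ψ c) (IsCode-ψ c code))
  from : ∀ {c} → c ∈ codes n → c ∈ map ψ (codes n)
  from {c} c∈ with ∈-codes⁻ n c∈
  ... | code , refl = subst (_∈ map ψ (codes (length c))) (ψ-ψ⁻¹ c)
        (∈-map⁺ ψ (subst (λ l → ψ⁻¹ c ∈ codes l) (length-ψ⁻¹ c) (∈-codes⁺ (ψ⁻¹ c) (IsCode-ψ⁻¹ c code))))

riseCutoff : List ℕ → ℕ
riseCutoff c = length c ∸ riseGap c ∸ 1

gap<k⇒head≤cutoff : ∀ c k → suc k ≤ length c → riseGap c < suc k →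
  suc (length c ∸ suc k) ≤ suc (length c) ∸ riseGap c ∸ 1
gap<k⇒head≤cutoff c k k<n d<k =
  subst (suc (length c ∸ suc k) ≤_) (sym (cong (_∸ 1) (+-∸-assoc 1 gap≤n))) (∸-monoʳ-< d<k k<n)
  where
  gap≤n : riseGap c ≤ length c
  gap≤n = ≤-trans (s≤s⁻¹ d<k) (≤-trans (n≤1+n k) k<n)

-- A letter counted here is below a later letter that starts a rising pair, so it is at most
-- riseCutoff c and no threshold from riseCutoff c on can tell it apart.
codeMatchCount-saturated : ∀ c → IsCode c → ∀ a b → riseCutoff c ≤ a → riseCutoff c ≤ b →
  codeMatchCount riseGap a c ≡ codeMatchCount riseGap b c
codeMatchCount-saturated []      _ a b _ _ = refl
codeMatchCount-saturated (zero ∷ c) (_ , code) a b a≥ b≥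
  rewrite ∧-zeroʳ (a <ᵇ suc (length c)) | ∧-zeroʳ (b <ᵇ suc (length c)) =
  codeMatchCount-saturated c code (a ⊓ length c) (b ⊓ length c) (⊓-glb a≥ cutoff≤n) (⊓-glb b≥ cutoff≤n)
  where
  cutoff≤n : riseCutoff c ≤ length c
  cutoff≤n = ≤-trans (m∸n≤m _ 1) (m∸n≤m (length c) (riseGap c))
codeMatchCount-saturated (suc k ∷ c) (k<n , code) a b a≥ b≥ with <-≤-connex (riseGap c) (suc k)
... | inj₁ d<k rewrite <ᵇ-true d<k
    | <ᵇ-false {a} {suc (length c ∸ suc k)} (≤-trans (gap<k⇒head≤cutoff c k k<n d<k) a≥)
    | <ᵇ-false {b} {suc (length c ∸ suc k)} (≤-trans (gap<k⇒head≤cutoff c k k<n d<k) b≥)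
    | m≥n⇒m⊓n≡n (≤-trans (n≤1+n _) (≤-trans (gap<k⇒head≤cutoff c k k<n d<k) a≥))
    | m≥n⇒m⊓n≡n (≤-trans (n≤1+n _) (≤-trans (gap<k⇒head≤cutoff c k k<n d<k) b≥)) = refl
... | inj₂ k≤d rewrite <ᵇ-false {riseGap c} {suc k} k≤d
    | ∧-zeroʳ (a <ᵇ suc (length c ∸ suc k)) | ∧-zeroʳ (b <ᵇ suc (length c ∸ suc k))
    | m≥n⇒m⊓n≡n (subst (_≤ a) (pred[m∸n]≡m∸[1+n] (length c) k) a≥)
    | m≥n⇒m⊓n≡n (subst (_≤ b) (pred[m∸n]≡m∸[1+n] (length c) k) b≥) = refl

codeMatchCount-⊓-saturated : ∀ c → IsCode c → ∀ t q₁ q₂ →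
  length c ∸ riseGap c ≤ q₁ → length c ∸ riseGap c ≤ q₂ →
  codeMatchCount riseGap (t ⊓ q₁) c ≡ codeMatchCount riseGap (t ⊓ q₂) c
codeMatchCount-⊓-saturated c code t q₁ q₂ q₁≥ q₂≥ with <-≤-connex t (riseCutoff c)
... | inj₁ t<L rewrite m≤n⇒m⊓n≡m (≤-trans (<⇒≤ t<L) (≤-trans (m∸n≤m _ 1) q₁≥))
                     | m≤n⇒m⊓n≡m (≤-trans (<⇒≤ t<L) (≤-trans (m∸n≤m _ 1) q₂≥)) = refl
... | inj₂ L≤t = codeMatchCount-saturated c code _ _
                   (⊓-glb L≤t (≤-trans (m∸n≤m _ 1) q₁≥)) (⊓-glb L≤t (≤-trans (m∸n≤m _ 1) q₂≥))

-- ψ keeps every code letter k with riseGap < k; at the others neither side counts a match and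
-- the prefix minima differ only above the cutoff.
codeMatchCount-ψ : ∀ c → IsCode c → ∀ t → codeMatchCount riseGap t c ≡ codeMatchCount fallGap t (ψ c)
codeMatchCount-ψ []      _ t = refl
codeMatchCount-ψ (zero ∷ c) (_ , code) t rewrite length-ψ c | fallGap-ψ c | <ᵇ-irrefl (riseGap c)
  | ∧-zeroʳ (t <ᵇ suc (length c)) | ∧-zeroʳ (t <ᵇ suc (length c ∸ riseGap c)) =
  ≡.trans (codeMatchCount-⊓-saturated c code t (length c) (length c ∸ riseGap c)
             (m∸n≤m (length c) (riseGap c)) ≤-refl)
          (codeMatchCount-ψ c code _)
codeMatchCount-ψ (suc k ∷ c) (_ , code) t with <-≤-connex (riseGap c) (suc k)
... | inj₁ d<k rewrite length-ψ c | fallGap-ψ c | <ᵇ-true d<k | <ᵇ-true d<k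
    | codeMatchCount-ψ c code (t ⊓ (length c ∸ suc k)) = refl
... | inj₂ k≤d rewrite length-ψ c | fallGap-ψ c
    | <ᵇ-false {riseGap c} {suc k} k≤d | <ᵇ-false {riseGap c} {k} (≤-trans (n≤1+n k) k≤d)
    | ∧-zeroʳ (t <ᵇ suc (length c ∸ suc k)) | ∧-zeroʳ (t <ᵇ suc (length c ∸ k)) =
  ≡.trans (codeMatchCount-⊓-saturated c code t (length c ∸ suc k) (length c ∸ k)
             (∸-monoʳ-≤ (length c) k≤d) (∸-monoʳ-≤ (length c) (≤-trans (n≤1+n k) k≤d)))
          (codeMatchCount-ψ c code _)

-- Ascents and descents

1+m∸k<ᵇ1+m∸k₂ : ∀ m k k₂ → k ≤ suc m → k₂ ≤ m → (suc m ∸ k <ᵇ suc (m ∸ k₂)) ≡ (k₂ <ᵇ k)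
1+m∸k<ᵇ1+m∸k₂ m k k₂ k≤ k₂≤ rewrite sym (+-∸-assoc 1 k₂≤) =
  T-ext (λ h → <⇒<ᵇ (∸-cancelʳ-< {k} {k₂} {suc m} (<ᵇ⇒<′ {suc m ∸ k} {suc m ∸ k₂} h)))
        (λ h → <⇒<ᵇ (∸-monoʳ-< (<ᵇ⇒<′ {k₂} {k} h) k≤))

<ᵇ-flip : ∀ p q → (q <ᵇ p) ≡ not (p <ᵇ suc q)
<ᵇ-flip p q with <-≤-connex q p
... | inj₁ q<p rewrite <ᵇ-true q<p | <ᵇ-false {p} {suc q} q<p = refl
... | inj₂ p≤q rewrite <ᵇ-false {q} {p} p≤q | <ᵇ-true {p} {suc q} (s≤s p≤q) = refl

at-map : ∀ (f : ℕ → ℕ) V j → suc j ≤ length V → at (map f V) (suc j) ≡ f (at V (suc j))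
at-map f (v ∷ V) zero    _       = refl
at-map f (v ∷ V) (suc j) (s≤s h) = at-map f V j h

at-decode-∷ : ∀ k c j → suc j ≤ length c →
  at (decode (k ∷ c)) (suc (suc j)) ≡ bump (suc (length c ∸ k)) (at (decode c) (suc j))
at-decode-∷ k c j j< = at-map (bump (suc (length c ∸ k))) (decode c) j (subst (suc j ≤_) (sym (length-decode c)) j<)

ascent-decode : ∀ c → IsCode c → ∀ j → 1 ≤ j → suc j ≤ length c →
  (at (decode c) j <ᵇ at (decode c) (suc j)) ≡ (at c (suc j) <ᵇ at c j)
ascent-decode (k ∷ k₂ ∷ c) (k≤ , k₂≤ , _) (suc zero) _ _ =
  ≡.trans (<ᵇ-bump (suc (length c) ∸ k) (suc (suc (length c) ∸ k)) (suc (length c ∸ k₂)))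
    (≡.trans (cong (_<ᵇ suc (length c ∸ k₂)) (unbump-self (suc (length c) ∸ k)))
             (1+m∸k<ᵇ1+m∸k₂ (length c) k k₂ k≤ k₂≤))
ascent-decode (k ∷ c) (_ , code) (suc (suc j)) _ (s≤s j<)
  rewrite at-decode-∷ k c j (<⇒≤ j<) | at-decode-∷ k c (suc j) j<
        | bump-<ᵇ-bump (suc (length c ∸ k)) (at (decode c) (suc j)) (at (decode c) (suc (suc j))) =
  ascent-decode c code (suc j) (s≤s z≤n) j<

descent-decode : ∀ c → IsCode c → ∀ j → 1 ≤ j → suc j ≤ length c →
  (at (decode c) (suc j) <ᵇ at (decode c) j) ≡ not (at c (suc j) <ᵇ at c j)
descent-decode (k ∷ k₂ ∷ c) (k≤ , k₂≤ , _) (suc zero) _ _ =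
  ≡.trans (bump-<ᵇ-gap (suc (suc (length c) ∸ k)) (suc (length c ∸ k₂)))
    (≡.trans (<ᵇ-flip (suc (length c) ∸ k) (length c ∸ k₂))
             (cong not (1+m∸k<ᵇ1+m∸k₂ (length c) k k₂ k≤ k₂≤)))
descent-decode (k ∷ c) (_ , code) (suc (suc j)) _ (s≤s j<)
  rewrite at-decode-∷ k c j (<⇒≤ j<) | at-decode-∷ k c (suc j) j<
        | bump-<ᵇ-bump (suc (length c ∸ k)) (at (decode c) (suc (suc j))) (at (decode c) (suc j)) =
  descent-decode c code (suc j) (s≤s z≤n) j<

WeaklyIncreasing : List ℕ → Set
WeaklyIncreasing r = ∀ i → 1 ≤ i → suc i ≤ length r → at r i ≤ at r (suc i)

StrictlyDecreasing : List ℕ → Set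
StrictlyDecreasing d = ∀ i → 1 ≤ i → suc i ≤ length d → at d (suc i) < at d i

riseGap-zeros : ∀ m → riseGap (replicate m 0) ≡ m
riseGap-zeros zero = refl
riseGap-zeros (suc m) = cong suc (riseGap-zeros m)

ψ-zeros : ∀ m → ψ (replicate m 0) ≡ downFrom m
ψ-zeros zero = refl
ψ-zeros (suc m) = cong₂ _∷_ (riseGap-zeros m) (ψ-zeros m)

fallGap-downFrom : ∀ m → fallGap (downFrom m) ≡ m
fallGap-downFrom zero = refl
fallGap-downFrom (suc zero) = refl
fallGap-downFrom (suc (suc m)) rewrite fallGap-downFrom (suc m) | <ᵇ-irrefl m = refl

ψ⁻¹-downFrom : ∀ m → ψ⁻¹ (downFrom m) ≡ replicate m 0
ψ⁻¹-downFrom zero = refl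
ψ⁻¹-downFrom (suc m) rewrite fallGap-downFrom m | <ᵇ-irrefl m | ≡ᵇ-refl m = cong (0 ∷_) (ψ⁻¹-downFrom m)

WeaklyIncreasing-∷ : ∀ {a r} → WeaklyIncreasing (a ∷ r) → WeaklyIncreasing r
WeaklyIncreasing-∷ h (suc i) _ l = h (suc (suc i)) (s≤s z≤n) (s≤s l)

StrictlyDecreasing-∷ : ∀ {a r} → StrictlyDecreasing (a ∷ r) → StrictlyDecreasing r
StrictlyDecreasing-∷ h (suc i) _ l = h (suc (suc i)) (s≤s z≤n) (s≤s l)

replicate-weaklyIncreasing : ∀ m → WeaklyIncreasing (replicate m 0)
replicate-weaklyIncreasing (suc (suc m)) (suc zero) _ _ = z≤n
replicate-weaklyIncreasing (suc m) (suc (suc i)) _ (s≤s l) = replicate-weaklyIncreasing m (suc i) (s≤s z≤n) l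

downFrom-strictlyDecreasing : ∀ m → StrictlyDecreasing (downFrom m)
downFrom-strictlyDecreasing (suc (suc m)) (suc zero) _ _ = ≤-refl
downFrom-strictlyDecreasing (suc m) (suc (suc i)) _ (s≤s l) = downFrom-strictlyDecreasing m (suc i) (s≤s z≤n) l

weaklyIncreasing-code : ∀ r → IsCode r → WeaklyIncreasing r → r ≡ replicate (length r) 0
weaklyIncreasing-code []              _              _   = refl
weaklyIncreasing-code (a ∷ [])        (z≤n , _)      _   = refl
weaklyIncreasing-code (a ∷ r@(_ ∷ _)) (_ , code) inc
  with r≡0s ← weaklyIncreasing-code r code (WeaklyIncreasing-∷ inc) =
  cong₂ _∷_ (n≤0⇒n≡0 (subst (a ≤_) (cong (λ l → at l 1) r≡0s) (inc 1 ≤-refl (s≤s (s≤s z≤n))))) r≡0s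

strictlyDecreasing-code : ∀ d → IsCode d → StrictlyDecreasing d → d ≡ downFrom (length d)
strictlyDecreasing-code []              _           _   = refl
strictlyDecreasing-code (a ∷ [])        (z≤n , _)   _   = refl
strictlyDecreasing-code (a ∷ d@(_ ∷ _)) (a≤ , code) dec
  with d≡↓ ← strictlyDecreasing-code d code (StrictlyDecreasing-∷ dec) =
  cong₂ _∷_ (≤-antisym a≤ (subst (_< a) (cong (λ l → at l 1) d≡↓) (dec 1 ≤-refl (s≤s (s≤s z≤n))))) d≡↓

ψ-ascentTail⇒descentTail : ∀ k r → IsCode (k ∷ r) → 1 ≤ length r → at r 1 < k → WeaklyIncreasing r →
  ψstep k (riseGap r) ≤ at (ψ r) 1 × StrictlyDecreasing (ψ r)
ψ-ascentTail⇒descentTail (suc k) r (k<n , code) 1≤n _ inc = go (length r) refl (weaklyIncreasing-code r code inc)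
  where
  go : ∀ m → length r ≡ m → r ≡ replicate m 0 →
    ψstep (suc k) (riseGap r) ≤ at (ψ r) 1 × StrictlyDecreasing (ψ r)
  go zero    n≡0 _ with () ← subst (1 ≤_) n≡0 1≤n
  go (suc m) _   refl rewrite riseGap-zeros m | ψ-zeros m | length-replicate m {0} | <ᵇ-false {suc m} {suc k} k<n =
    s≤s⁻¹ k<n , downFrom-strictlyDecreasing (suc m)

ψ-descentTail⇒ascentTail : ∀ k r → IsCode (k ∷ r) → 1 ≤ length r → ψstep k (riseGap r) ≤ at (ψ r) 1 →
  StrictlyDecreasing (ψ r) → at r 1 < k × WeaklyIncreasing r
ψ-descentTail⇒ascentTail k r@(_ ∷ r') (_ , code) _ ψ-head dec =
  subst (λ z → ψstep k (riseGap z) ≤ at (ψ z) 1 → at z 1 < k × WeaklyIncreasing z) (sym r≡0s) (zeros k) ψ-head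
  where
  r≡0s : r ≡ replicate (length r) 0
  r≡0s = begin
    r                                ≡⟨ ψ⁻¹-ψ r ⟨
    ψ⁻¹ (ψ r)                        ≡⟨ cong ψ⁻¹ (strictlyDecreasing-code (ψ r) (IsCode-ψ r code) dec) ⟩
    ψ⁻¹ (downFrom (length (ψ r)))    ≡⟨ cong (ψ⁻¹ ∘ downFrom) (length-ψ r) ⟩
    ψ⁻¹ (downFrom (length r))        ≡⟨ ψ⁻¹-downFrom (length r) ⟩
    replicate (length r) 0           ∎
    where open ≡-Reasoning
  zeros : ∀ k → ψstep k (riseGap (replicate (suc (length r')) 0)) ≤ at (ψ (replicate (suc (length r')) 0)) 1 →
    0 < k × WeaklyIncreasing (replicate (suc (length r')) 0)
  zeros zero    le rewrite riseGap-zeros (length r') = ⊥-elim (<-irrefl refl le)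
  zeros (suc k) _  = s≤s z≤n , replicate-weaklyIncreasing (suc (length r'))

LastAscentShape : List ℕ → ℕ → Set
LastAscentShape c s = at c (suc s) < at c s × (∀ j → suc s ≤ j → suc j ≤ length c → at c j ≤ at c (suc j))

LastDescentShape : List ℕ → ℕ → Set
LastDescentShape d s = at d s ≤ at d (suc s) × (∀ j → suc s ≤ j → suc j ≤ length d → at d (suc j) < at d j)

lastAscentShape⇔lastDescentShape-ψ : ∀ c → IsCode c → ∀ s → 1 ≤ s → suc s ≤ length c →
  (LastAscentShape c s → LastDescentShape (ψ c) s) × (LastDescentShape (ψ c) s → LastAscentShape c s)
lastAscentShape⇔lastDescentShape-ψ (k ∷ r) code (suc zero) _ (s≤s 1≤n) = to , from
  where
  to : LastAscentShape (k ∷ r) 1 → LastDescentShape (ψ (k ∷ r)) 1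
  to (r₁<k , inc) with ψ-ascentTail⇒descentTail k r code 1≤n r₁<k
                         (λ { (suc i) _ i< → inc (suc (suc i)) (s≤s (s≤s z≤n)) (s≤s i<) })
  ... | head , dec = head , λ { (suc zero) (s≤s ()) _ ; (suc (suc j)) _ (s≤s j<) → dec (suc j) (s≤s z≤n) j< }
  from : LastDescentShape (ψ (k ∷ r)) 1 → LastAscentShape (k ∷ r) 1
  from (head , dec) with ψ-descentTail⇒ascentTail k r code 1≤n head
                           (λ { (suc i) _ i< → dec (suc (suc i)) (s≤s (s≤s z≤n)) (s≤s i<) })
  ... | r₁<k , inc = r₁<k , λ { (suc zero) (s≤s ()) _ ; (suc (suc j)) _ (s≤s j<) → inc (suc j) (s≤s z≤n) j< }
lastAscentShape⇔lastDescentShape-ψ (k ∷ c) (_ , code) (suc (suc s)) _ (s≤s s<n)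
  with lastAscentShape⇔lastDescentShape-ψ c code (suc s) (s≤s z≤n) s<n
... | to′ , from′ = to , from
  where
  to : LastAscentShape (k ∷ c) (suc (suc s)) → LastDescentShape (ψ (k ∷ c)) (suc (suc s))
  to (desc , inc) with to′ (desc , λ { (suc j) j≥ j< → inc (suc (suc j)) (s≤s j≥) (s≤s j<) })
  ... | asc , dec = asc , λ { (suc (suc j)) (s≤s j≥) (s≤s j<) → dec (suc j) j≥ j< }
  from : LastDescentShape (ψ (k ∷ c)) (suc (suc s)) → LastAscentShape (k ∷ c) (suc (suc s))
  from (asc , dec) with from′ (asc , λ { (suc j) j≥ j< → dec (suc (suc j)) (s≤s j≥) (s≤s j<) })
  ... | desc , inc = desc , λ { (suc (suc j)) (s≤s j≥) (s≤s j<) → inc (suc j) j≥ j< }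

∈-after⁺ : ∀ {s n j} → suc s ≤ j → suc j ≤ n → j ∈ range (suc s) (n ∸ 1)
∈-after⁺ {s} {suc n} {suc j} s<j (s≤s j<n) = ∈-range⁺ {suc s} {n} {j} s<j j<n

∈-after⁻ : ∀ {s n j} → j ∈ range (suc s) (n ∸ 1) → suc s ≤ j × suc j ≤ n
∈-after⁻ {s} {zero}  j∈ with ∈-range⁻ {suc s} {0} j∈
... | s<j , j≤0 = ⊥-elim (<⇒≱ (≤-trans (s≤s z≤n) s<j) j≤0)
∈-after⁻ {s} {suc n} j∈ with ∈-range⁻ {suc s} {n} j∈
... | s<j , j≤n = s<j , s≤s j≤n

module _ (c : List ℕ) (code : IsCode c) (s : ℕ) (1≤s : 1 ≤ s) (s<n : suc s ≤ length c) where

  private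
    n = length c
    1≤j : ∀ {j} → suc s ≤ j → 1 ≤ j
    1≤j s<j = ≤-trans 1≤s (≤-trans (n≤1+n s) s<j)

  lastAscent⇒shape : T (lastAscentAt n (decode c) s) → LastAscentShape c s
  lastAscent⇒shape t with T-∧⁻ {at (decode c) s <ᵇ at (decode c) (suc s)} t
  ... | asc , descs = <ᵇ⇒<′ (subst T (ascent-decode c code s 1≤s s<n) asc) , weak
    where
    weak : ∀ j → suc s ≤ j → suc j ≤ n → at c j ≤ at c (suc j)
    weak j s<j j<n = ≮⇒≥ λ lt →
      T-not⁻ (subst T (descent-decode c code j (1≤j s<j) j<n) (allIn⁻ _ _ descs (∈-after⁺ s<j j<n))) (<⇒<ᵇ lt)

  shape⇒lastAscent : LastAscentShape c s → T (lastAscentAt n (decode c) s)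
  shape⇒lastAscent (desc , inc) = T-∧⁺ {at (decode c) s <ᵇ at (decode c) (suc s)}
    (subst T (sym (ascent-decode c code s 1≤s s<n)) (<⇒<ᵇ desc))
    (allIn⁺ _ _ λ j∈ → let s<j , j<n = ∈-after⁻ j∈ in
      subst T (sym (descent-decode c code _ (1≤j s<j) j<n))
        (T-not⁺ (λ t → <⇒≱ (<ᵇ⇒<′ t) (inc _ s<j j<n))))

  lastDescent⇒shape : T (lastDescentAt n (decode c) s) → LastDescentShape c s
  lastDescent⇒shape t with T-∧⁻ {at (decode c) (suc s) <ᵇ at (decode c) s} t
  ... | desc , ascs =
    ≮⇒≥ (λ lt → T-not⁻ (subst T (descent-decode c code s 1≤s s<n) desc) (<⇒<ᵇ lt)) ,
    λ j s<j j<n → <ᵇ⇒<′ (subst T (ascent-decode c code j (1≤j s<j) j<n) (allIn⁻ _ _ ascs (∈-after⁺ s<j j<n)))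

  shape⇒lastDescent : LastDescentShape c s → T (lastDescentAt n (decode c) s)
  shape⇒lastDescent (asc , dec) = T-∧⁺ {at (decode c) (suc s) <ᵇ at (decode c) s}
    (subst T (sym (descent-decode c code s 1≤s s<n)) (T-not⁺ (λ t → <⇒≱ (<ᵇ⇒<′ t) asc)))
    (allIn⁺ _ _ λ j∈ → let s<j , j<n = ∈-after⁻ j∈ in
      subst T (sym (ascent-decode c code _ (1≤j s<j) j<n)) (<⇒<ᵇ (dec _ s<j j<n)))

lastAscent-decode≡lastDescent-decode-ψ : ∀ n c → IsCode c → length c ≡ n → ∀ s → 1 ≤ s → suc s ≤ n →
  lastAscentAt n (decode c) s ≡ lastDescentAt n (decode (ψ c)) s
lastAscent-decode≡lastDescent-decode-ψ _ c code refl s 1≤s s<n = T-ext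
  (λ t → shape⇒lastDescent′ (proj₁ shapes (lastAscent⇒shape c code s 1≤s s<n t)))
  (λ t → shape⇒lastAscent c code s 1≤s s<n (proj₂ shapes (lastDescent⇒shape′ t)))
  where
  shapes = lastAscentShape⇔lastDescentShape-ψ c code s 1≤s s<n
  ψ-code = IsCode-ψ c code
  s<n′ = subst (suc s ≤_) (sym (length-ψ c)) s<n
  shape⇒lastDescent′ : LastDescentShape (ψ c) s → T (lastDescentAt (length c) (decode (ψ c)) s)
  shape⇒lastDescent′ = subst (λ m → LastDescentShape (ψ c) s → T (lastDescentAt m (decode (ψ c)) s))
    (length-ψ c) (shape⇒lastDescent (ψ c) ψ-code s 1≤s s<n′)
  lastDescent⇒shape′ : T (lastDescentAt (length c) (decode (ψ c)) s) → LastDescentShape (ψ c) s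
  lastDescent⇒shape′ = subst (λ m → T (lastDescentAt m (decode (ψ c)) s) → LastDescentShape (ψ c) s)
    (length-ψ c) (lastDescent⇒shape (ψ c) ψ-code s 1≤s s<n′)

pmp1234-decode≡pmp1243-decode-ψ : ∀ n c → IsCode c → length c ≡ n → pmp1234 n (decode c) ≡ pmp1243 n (decode (ψ c))
pmp1234-decode≡pmp1243-decode-ψ n c code refl = begin
  pmp1234 n (decode c)
    ≡⟨ Scan.count-matchAt rising n (decode c) (length-decode c) (at-decode-≤ c) ⟩
  Scan.matchCount rising n (decode c)
    ≡⟨ matchCount-decode rising-invariant riseGap pairAbove-rising-decode c code n ⟩
  codeMatchCount riseGap n c
    ≡⟨ codeMatchCount-ψ c code n ⟩
  codeMatchCount fallGap n (ψ c)
    ≡⟨ matchCount-decode falling-invariant fallGap pairAbove-falling-decode (ψ c) (IsCode-ψ c code) n ⟨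
  Scan.matchCount falling n (decode (ψ c))
    ≡⟨ Scan.count-matchAt falling n (decode (ψ c)) ψ-len ψ-bound ⟨
  pmp1243 n (decode (ψ c))
    ∎
  where
  open ≡-Reasoning
  ψ-len : length (decode (ψ c)) ≡ n
  ψ-len = ≡.trans (length-decode (ψ c)) (length-ψ c)
  ψ-bound : ∀ i → at (decode (ψ c)) i ≤ n
  ψ-bound i = subst (at (decode (ψ c)) i ≤_) (length-ψ c) (at-decode-≤ (ψ c) i)

lemma11 : (n s : ℕ) → 2 ≤ n → 1 ≤ s → s ≤ n ∸ 1 →
    (k : ℕ) → coeffP₁ n s k ≡ coeffP₂ n s k
lemma11 n@(suc _) s _ 1≤s s≤n-1 k = begin
  count (Sym n) P                              ≡⟨ count-↭ P (decode-codes↭Sym n) ⟨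
  count (map decode (codes n)) P               ≡⟨ count-map decode P (codes n) ⟩
  count (codes n) (λ c → P (decode c))         ≡⟨ count-cong (codes n) P-decode≡Q-decode-ψ ⟩
  count (codes n) (λ c → Q (decode (ψ c)))     ≡⟨ count-map ψ (λ c → Q (decode c)) (codes n) ⟨
  count (map ψ (codes n)) (λ c → Q (decode c)) ≡⟨ count-↭ (λ c → Q (decode c)) (ψ-codes↭codes n) ⟩
  count (codes n) (λ c → Q (decode c))         ≡⟨ count-map decode Q (codes n) ⟨
  count (map decode (codes n)) Q               ≡⟨ count-↭ Q (decode-codes↭Sym n) ⟩
  count (Sym n) Q                              ∎
  where
  open ≡-Reasoning
  P Q : List ℕ → Bool
  P σ = lastAscentAt n σ s ∧ (pmp1234 n σ ≡ᵇ k)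
  Q σ = lastDescentAt n σ s ∧ (pmp1243 n σ ≡ᵇ k)
  P-decode≡Q-decode-ψ : ∀ {c} → c ∈ codes n → P (decode c) ≡ Q (decode (ψ c))
  P-decode≡Q-decode-ψ {c} c∈ with ∈-codes⁻ n c∈
  ... | code , len = cong₂ (λ a b → a ∧ (b ≡ᵇ k))
    (lastAscent-decode≡lastDescent-decode-ψ n c code len s 1≤s (s≤s s≤n-1))
    (pmp1234-decode≡pmp1243-decode-ψ n c code len)
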